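{- Let $p$ be an odd prime, $k=\mathbb{F}_p$, $R=k[x,y,z]$, $g\geq 2$, let $h(x)\in k[x]$ be a polynomial without multiple roots of degree $2g+1$, $h(x,z)=z^{2g+1}h(x/z)$, and $f=y^2z^{2g-1}-h(x,z)$. For $r\geq 1$ write $h(x)^{(p^r-1)/2}=\sum_j c^{(r)}_jx^j$ and let $C_r$ be the $g\times g$ matrix with $(i,j)$ entry $c^{(r)}_{ip^r-j}$. Then for every $r\geq 1$, the polynomials $h_{r,1},\ldots,h_{r,g}$ defined by \[ \begin{bmatrix} h_{r,1} & h_{r,2} & \cdots & h_{r,g}\end{bmatrix}=\begin{bmatrix} z^{2g-2} & xz^{2g-3} & \cdots & x^{g-1}z^{g-1}\end{bmatrix}C_r \] belong to $I_r(f^{p^r-1})$ (so they can be taken as part of a generating set of this ideal).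
   Context: For $e\ge 0$ and $q\in R$, $I_e(q)$ is the smallest ideal $J$ of $R$ such that $q$ lies in the ideal generated by the $p^e$-th powers of elements of $J$. -}

module Defs where

open import Data.Nat using (ℕ; zero; suc; _+_; _*_; _∸_; _^_; _≤_; _<_; _≡ᵇ_; _≤ᵇ_; ⌊_/2⌋)
open import Data.Bool using (Bool; true; false; if_then_else_; _∧_)
open import Data.List using (List; []; _∷_; _++_; map; concatMap; upTo; foldr)
open import Data.List.Relation.Unary.All using (All)
open import Data.Product using (Σ; _×_; _,_; ∃; ∃-syntax; proj₁; proj₂)
open import Relation.Binary.PropositionalEquality using (_≡_)
open import Relation.Nullary using (¬_)

-- Arithmetic in k = 𝔽_p: natural numbers read modulo p.

ModEq : ℕ → ℕ → ℕ → Set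
ModEq p m n = ∃[ a ] ∃[ b ] (m + a * p ≡ n + b * p)

-- Univariate polynomials k[x]: dense little-endian coefficient lists
-- (coefficients are naturals read modulo p).

UPoly : Set
UPoly = List ℕ

addU : UPoly → UPoly → UPoly
addU [] q = q
addU (a ∷ f) [] = a ∷ f
addU (a ∷ f) (b ∷ q) = (a + b) ∷ addU f q

scaleU : ℕ → UPoly → UPoly
scaleU c = map (c *_)

mulU : UPoly → UPoly → UPoly
mulU [] q = []
mulU (a ∷ f) q = addU (scaleU a q) (0 ∷ mulU f q)

oneU : UPoly
oneU = 1 ∷ []

powU : UPoly → ℕ → UPoly
powU f zero = oneU
powU f (suc n) = mulU f (powU f n)

coeffU : UPoly → ℕ → ℕ
coeffU [] _ = 0
coeffU (a ∷ _) zero = a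
coeffU (_ ∷ f) (suc i) = coeffU f i

derivFrom : ℕ → UPoly → UPoly
derivFrom k [] = []
derivFrom k (a ∷ f) = (k * a) ∷ derivFrom (suc k) f

derivU : UPoly → UPoly
derivU [] = []
derivU (_ ∷ f) = derivFrom 1 f

UEq : ℕ → UPoly → UPoly → Set
UEq p f q = ∀ i → ModEq p (coeffU f i) (coeffU q i)

HasDegree : ℕ → UPoly → ℕ → Set
HasDegree p f d = (¬ ModEq p (coeffU f d) 0) × (∀ i → d < i → ModEq p (coeffU f i) 0)

-- f has no multiple roots (is separable): gcd(f, f') = 1 in 𝔽_p[x]
Separable : ℕ → UPoly → Set
Separable p f = ∃[ a ] ∃[ b ] UEq p (addU (mulU a f) (mulU b (derivU f))) oneU

-- R = k[x,y,z]: sparse lists of terms  c · x^a y^b z^e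

Mono : Set
Mono = ℕ × ℕ × ℕ

Poly : Set
Poly = List (ℕ × Mono)

term : ℕ → ℕ → ℕ → ℕ → Poly
term c a b e = (c , a , b , e) ∷ []

rawCoeff : Poly → Mono → ℕ
rawCoeff [] _ = 0
rawCoeff ((c , a , b , e) ∷ P) (a' , b' , e') =
  (if (a ≡ᵇ a') ∧ ((b ≡ᵇ b') ∧ (e ≡ᵇ e')) then c else 0) + rawCoeff P (a' , b' , e')

PolyEq : ℕ → Poly → Poly → Set
PolyEq p P Q = ∀ m → ModEq p (rawCoeff P m) (rawCoeff Q m)

zeroP : Poly
zeroP = []

oneP : Poly
oneP = term 1 0 0 0

addP : Poly → Poly → Poly
addP = _++_

mulTerm : ℕ × Mono → ℕ × Mono → ℕ × Mono
mulTerm (c , a , b , e) (c' , a' , b' , e') = (c * c' , a + a' , b + b' , e + e')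

mulP : Poly → Poly → Poly
mulP P Q = concatMap (λ s → map (mulTerm s) Q) P

negTerm : ℕ → ℕ × Mono → ℕ × Mono
negTerm p (c , m) = ((p ∸ 1) * c , m)

-- additive inverse in 𝔽_p[x,y,z]  (multiplication by p-1 ≡ -1)
negP : ℕ → Poly → Poly
negP p = map (negTerm p)

powP : Poly → ℕ → Poly
powP P zero = oneP
powP P (suc n) = mulP P (powP P n)

sumP : List Poly → Poly
sumP = foldr addP zeroP

record IsIdeal (p : ℕ) (J : Poly → Set) : Set where
  field
    respects : ∀ {P Q} → PolyEq p P Q → J P → J Q
    zero∈    : J zeroP
    +-closed : ∀ {P Q} → J P → J Q → J (addP P Q)
    *-closed : ∀ S {P} → J P → J (mulP S P)

InFrobPow : ℕ → ℕ → (Poly → Set) → Poly → Set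
InFrobPow p e J q =
  Σ (List (Poly × Poly)) λ gens →
    All (λ st → J (proj₂ st)) gens ×
    PolyEq p q (sumP (map (λ st → mulP (proj₁ st) (powP (proj₂ st) (p ^ e))) gens))

-- u ∈ I_e(q): u lies in the smallest ideal J with q ∈ J^[p^e],
-- i.e. in every ideal J with q ∈ J^[p^e].
InI : ℕ → ℕ → Poly → Poly → Set₁
InI p e q u = (J : Poly → Set) → IsIdeal p J → InFrobPow p e J q → J u

-- h(x,z) = z^{2g+1} h(x/z) = Σ_{i ≤ 2g+1} h_i x^i z^{2g+1-i}
homog : ℕ → UPoly → Poly
homog g h = map (λ i → (coeffU h i , i , 0 , (2 * g + 1) ∸ i)) (upTo (2 * g + 2))

fPoly : ℕ → ℕ → UPoly → Poly
fPoly p g h = addP (term 1 0 2 (2 * g ∸ 1)) (negP p (homog g h))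

cCoeff : ℕ → UPoly → ℕ → ℕ → ℕ
cCoeff p h r j = coeffU (powU h ⌊ (p ^ r ∸ 1) /2⌋) j

-- (C_r)_{i,j} = c^{(r)}_{i p^r - j}  (zero when the index is negative)
Cmat : ℕ → UPoly → ℕ → ℕ → ℕ → ℕ
Cmat p h r i j = if j ≤ᵇ i * p ^ r then cCoeff p h r (i * p ^ r ∸ j) else 0

-- h_{r,j} = Σ_{i=1}^{g} x^{i-1} z^{2g-1-i} (C_r)_{i,j}   (here i = i'+1)
hPoly : ℕ → ℕ → UPoly → ℕ → ℕ → Poly
hPoly p g h r j = map (λ i' → (Cmat p h r (suc i') j , i' , 0 , (2 * g ∸ 2) ∸ i')) (upTo g)

module Submission where

-- Write q = p^r = 2N + 1 and F = f^(q-1).  Every polynomial is uniquely a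
-- sum Σ_μ u_μ^q · μ over the "basis monomials" μ = x^a y^b z^c with
-- a, b, c < q.  For a fixed basis monomial, the operator E that reads off
-- the coefficient u_μ is additive and satisfies E(S · T^q) = E(S) · T
-- (q-th powers are Frobenius twists, because (X + Y)^p ≡ X^p + Y^p and
-- c^p ≡ c modulo p).  Hence, whenever F = Σ s_i t_i^q with all t_i ∈ J,
-- the polynomial E(F) = Σ E(s_i) t_i lies in J; so E(F) ∈ I_r(F).
--
-- For μ = x^(q-j) y^(q-1) z^(q-2g+j) we compute E(F) explicitly.  In the
-- binomial expansion of F = (y²z^(2g-1) - h(x,z))^(2N) only the middle term
-- has y-degree 2N = q-1, and h(x,z)^N is the homogenisation of h(x)^N.
-- Comparing coefficients gives E(F) ≡ u · h_{r,j} with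
-- u = C(2N, N)·(-1)^N.  Since p ∤ C(q-1, N) (Pascal's rule together with
-- p | C(q, k) for 0 < k < q) the scalar u is a unit mod p, and
-- h_{r,j} ≡ u⁻¹ · E(F) lies in every ideal J, i.e. in I_r(F).

open import Algebra.Bundles using (CommutativeSemiring)
open import Data.Nat as ℕ using (ℕ; zero; suc; _<_; z<s; s<s)
import Data.Nat.Properties as NP
open import Data.Nat.Combinatorics using (nCn≡1) renaming (_C_ to binom)
open import Data.Fin using (Fin; toℕ; inject₁; fromℕ; fromℕ<)
open import Data.Fin.Properties using (toℕ<n; toℕ-inject₁; toℕ-fromℕ; toℕ-fromℕ<)
open import Data.Product using (Σ; _,_; proj₁; proj₂)
import Relation.Binary.PropositionalEquality as ≡
open ≡ using (_≡_)
open import Data.Vec.Functional using (Vector; init; last; tail)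

-- Used for ℕ (Fermat's little theorem) and for polynomials (Frobenius).
module FrobeniusBinomial {a ℓ} (S : CommutativeSemiring a ℓ) where
  open CommutativeSemiring S hiding (zero)
  open import Algebra.Properties.CommutativeSemiring.Binomial S
  open import Algebra.Properties.Semiring.Exp semiring using (_^_)
  open import Algebra.Properties.Semiring.Mult semiring using (_×_; ×-congˡ; ×-assocˡ; ×-homo-1)
  open import Algebra.Properties.Monoid.Sum +-monoid using (sum; sum-init-last; sum-cong-≋)
  import Algebra.Properties.CommutativeMonoid.Mult +-commutativeMonoid as CMM
  open import Relation.Binary.Reasoning.Setoid setoid

  ×-zero : ∀ n → n × 0# ≈ 0#
  ×-zero zero = refl
  ×-zero (suc n) = trans (+-identityˡ _) (×-zero n)

  sum-× : ∀ {n} k (w : Vector Carrier n) → sum (λ i → k × w i) ≈ k × sum w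
  sum-× {zero} k w = sym (×-zero k)
  sum-× {suc n} k w = trans (+-congˡ (sum-× k (tail w))) (sym (CMM.×-distrib-+ (w Fin.zero) (sum (tail w)) k))

  frobenius-binomial : ∀ q → let p = suc (suc q) in
    (∀ k → 0 < k → k < p → Σ ℕ λ m → binom p k ≡ p ℕ.* m) →
    ∀ x y → Σ Carrier λ z → (x + y) ^ p ≈ (x ^ p + y ^ p) + p × z
  frobenius-binomial q p∣C x y = z , expansion
    where
      p = suc (suc q)
      v : Vector Carrier (suc p)
      v k = binomialTerm x y p k
      inner : (i : Fin (suc q)) → Σ ℕ λ m → binom p (toℕ (Fin.suc (inject₁ i))) ≡ p ℕ.* m
      inner i = ≡.subst (λ t → Σ ℕ λ m → binom p t ≡ p ℕ.* m) (≡.cong suc (≡.sym (toℕ-inject₁ i)))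
                  (p∣C (suc (toℕ i)) z<s (s<s (toℕ<n i)))
      w : Vector Carrier (suc q)
      w i = proj₁ (inner i) × binomial x y p (Fin.suc (inject₁ i))
      z = sum w
      innerTerm : ∀ i → init (tail v) i ≈ p × w i
      innerTerm i = begin
        binom p (toℕ (Fin.suc (inject₁ i))) × binomial x y p (Fin.suc (inject₁ i))
          ≈⟨ ×-congˡ (proj₂ (inner i)) ⟩
        (p ℕ.* proj₁ (inner i)) × binomial x y p (Fin.suc (inject₁ i))
          ≈⟨ ×-assocˡ _ p (proj₁ (inner i)) ⟨
        p × w i ∎
      lastTerm : last (tail v) ≈ x ^ p
      lastTerm = begin
        binom p (toℕ (fromℕ p)) × (x ^ toℕ (fromℕ p) * y ^ (p ℕ.∸ toℕ (fromℕ p)))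
          ≡⟨ ≡.cong (λ t → binom p t × (x ^ t * y ^ (p ℕ.∸ t))) (toℕ-fromℕ p) ⟩
        binom p p × (x ^ p * y ^ (p ℕ.∸ p))
          ≡⟨ top (nCn≡1 p) (NP.n∸n≡0 p) ⟩
        1 × (x ^ p * 1#)
          ≈⟨ ×-homo-1 _ ⟩
        x ^ p * 1#
          ≈⟨ *-identityʳ _ ⟩
        x ^ p ∎
        where top : ∀ {c d} → c ≡ 1 → d ≡ 0 → (c × (x ^ p * y ^ d)) ≡ (1 × (x ^ p * 1#))
              top ≡.refl ≡.refl = ≡.refl
      firstTerm : v Fin.zero ≈ y ^ p
      firstTerm = trans (×-homo-1 _) (*-identityˡ _)
      expansion : (x + y) ^ p ≈ (x ^ p + y ^ p) + p × z
      expansion = begin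
        (x + y) ^ p ≈⟨ theorem p x y ⟩
        sum v ≈⟨ +-congˡ (sum-init-last (tail v)) ⟩
        v Fin.zero + (sum (init (tail v)) + last (tail v))
          ≈⟨ +-cong firstTerm (+-cong (trans (sum-cong-≋ innerTerm) (sum-× p w)) lastTerm) ⟩
        y ^ p + (p × z + x ^ p) ≈⟨ +-congˡ (+-comm _ _) ⟩
        y ^ p + (x ^ p + p × z) ≈⟨ +-assoc _ _ _ ⟨
        (y ^ p + x ^ p) + p × z ≈⟨ +-congʳ (+-comm _ _) ⟩
        (x ^ p + y ^ p) + p × z ∎

open import Defs
open import Data.Nat using (_+_; _*_; _∸_; _^_; _≤_; _≡ᵇ_; _≤ᵇ_; _<ᵇ_; NonZero; ≢-nonZero; z≤n; s≤s; _≟_; _≤?_; _/_; _%_; _!; ⌊_/2⌋)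
open import Data.Nat.Properties
open import Data.Nat.DivMod
open import Data.Nat.Combinatorics using (nCk≡n!/k![n-k]!; k![n∸k]!∣n!; nCk+nC[k+1]≡[n+1]C[k+1])
open import Data.Nat.Divisibility using (_∣_; divides; ∣⇒≤; ∣1⇒≡1; ∣m+n∣m⇒∣n; m%n≡0⇒n∣m; m∣m*n)
open import Data.Nat.Primality using (Prime; prime⇒nonTrivial; prime⇒nonZero; prime⇒irreducible; euclidsLemma)
open import Data.Nat.Coprimality using (prime⇒coprime; coprime-Bézout)
open import Data.Nat.GCD using (module Bézout)
open import Data.Nat.Tactic.RingSolver
open import Data.Bool using (Bool; true; false; if_then_else_; _∧_)
open import Data.Bool.Properties using (∧-zeroʳ)
open import Data.List using ([]; _∷_; _++_; map; concatMap; upTo; applyUpTo)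
import Data.List.Properties as LP
open import Data.List.Relation.Unary.All as All using (All)
import Data.List.Relation.Unary.All.Properties as AP
open import Data.Product using (_×_)
open import Data.Sum using (_⊎_; inj₁; inj₂)
open import Data.Empty using (⊥-elim)
open import Relation.Binary.PropositionalEquality
open import Relation.Nullary using (¬_; yes; no)
open import Relation.Binary.Structures using (IsEquivalence)
open import Level using (0ℓ)
import Algebra.Structures.Biased as Biased

module _ {p : ℕ} where
  ≡p-refl : ∀ {m} → ModEq p m m
  ≡p-refl = 0 , 0 , refl

  ≡p-≡ : ∀ {m n} → m ≡ n → ModEq p m n
  ≡p-≡ refl = ≡p-refl

  ≡p-sym : ∀ {m n} → ModEq p m n → ModEq p n m
  ≡p-sym (a , b , e) = b , a , sym e

  ≡p-trans : ∀ {m n k} → ModEq p m n → ModEq p n k → ModEq p m k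
  ≡p-trans {m} {n} {k} (a , b , e₁) (c , d , e₂) = a + c , d + b , (begin
      m + (a + c) * p       ≡⟨ solve (m ∷ a ∷ c ∷ p ∷ []) ⟩
      (m + a * p) + c * p   ≡⟨ cong (_+ c * p) e₁ ⟩
      (n + b * p) + c * p   ≡⟨ solve (n ∷ b ∷ c ∷ p ∷ []) ⟩
      (n + c * p) + b * p   ≡⟨ cong (_+ b * p) e₂ ⟩
      (k + d * p) + b * p   ≡⟨ solve (k ∷ d ∷ b ∷ p ∷ []) ⟩
      k + (d + b) * p ∎)
    where open ≡-Reasoning

  ≡p-+ : ∀ {m n m' n'} → ModEq p m n → ModEq p m' n' → ModEq p (m + m') (n + n')
  ≡p-+ {m} {n} {m'} {n'} (a , b , e₁) (c , d , e₂) = a + c , b + d , (begin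
      (m + m') + (a + c) * p       ≡⟨ solve (m ∷ m' ∷ a ∷ c ∷ p ∷ []) ⟩
      (m + a * p) + (m' + c * p)   ≡⟨ cong₂ _+_ e₁ e₂ ⟩
      (n + b * p) + (n' + d * p)   ≡⟨ solve (n ∷ n' ∷ b ∷ d ∷ p ∷ []) ⟩
      (n + n') + (b + d) * p ∎)
    where open ≡-Reasoning

  ≡p-*ˡ : ∀ c {m n} → ModEq p m n → ModEq p (c * m) (c * n)
  ≡p-*ˡ c {m} {n} (a , b , e) = c * a , c * b , (begin
      c * m + c * a * p   ≡⟨ solve (c ∷ m ∷ a ∷ p ∷ []) ⟩
      c * (m + a * p)     ≡⟨ cong (c *_) e ⟩
      c * (n + b * p)     ≡⟨ solve (c ∷ n ∷ b ∷ p ∷ []) ⟩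
      c * n + c * b * p ∎)
    where open ≡-Reasoning

  ≡p-* : ∀ {m n m' n'} → ModEq p m n → ModEq p m' n' → ModEq p (m * m') (n * n')
  ≡p-* {m} {n} {m'} e₁ e₂ =
    ≡p-trans (≡p-≡ (*-comm m m')) (≡p-trans (≡p-*ˡ m' e₁)
      (≡p-trans (≡p-≡ (*-comm m' n)) (≡p-*ˡ n e₂)))

  ≡p-drop : ∀ x z → ModEq p (x + p * z) x
  ≡p-drop x z = 0 , z , trans (+-identityʳ (x + p * z)) (cong (x +_) (*-comm p z))

  ≡p-if : ∀ b {x y} → ModEq p x y → ModEq p (if b then x else 0) (if b then y else 0)
  ≡p-if true e = e
  ≡p-if false e = ≡p-refl

  ≡p-if0 : ∀ b {x} → ModEq p x 0 → ModEq p (if b then x else 0) 0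
  ≡p-if0 true e = e
  ≡p-if0 false e = ≡p-refl

  ≡p-0⇒∣ : ∀ {x} → ModEq p x 0 → p ∣ x
  ≡p-0⇒∣ {x} (a , b , eq) = divides (b ∸ a) (begin
      x                      ≡⟨ sym (m+n∸n≡m x (a * p)) ⟩
      x + a * p ∸ a * p      ≡⟨ cong (_∸ a * p) eq ⟩
      b * p ∸ a * p          ≡⟨ sym (*-distribʳ-∸ p b a) ⟩
      (b ∸ a) * p ∎)
    where open ≡-Reasoning

-- Boolean comparisons of naturals, turned into propositional equations so
-- that coefficient formulas (which are `if … then … else 0`) can be rewritten.
≡ᵇ-refl : ∀ m → (m ≡ᵇ m) ≡ true
≡ᵇ-refl zero = refl
≡ᵇ-refl (suc m) = ≡ᵇ-refl m

≡ᵇ-≡ : ∀ {m n} → m ≡ n → (m ≡ᵇ n) ≡ true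
≡ᵇ-≡ {m} refl = ≡ᵇ-refl m

≡ᵇ-≢ : ∀ {m n} → m ≢ n → (m ≡ᵇ n) ≡ false
≡ᵇ-≢ {zero} {zero} ne = ⊥-elim (ne refl)
≡ᵇ-≢ {zero} {suc n} ne = refl
≡ᵇ-≢ {suc m} {zero} ne = refl
≡ᵇ-≢ {suc m} {suc n} ne = ≡ᵇ-≢ (λ e → ne (cong suc e))

≤ᵇ-≤ : ∀ {m n} → m ≤ n → (m ≤ᵇ n) ≡ true
≤ᵇ-≤ {m} {n} le with m ≤ᵇ n | ≤⇒≤ᵇ le
... | true | _ = refl

≤ᵇ-≰ : ∀ {m n} → ¬ (m ≤ n) → (m ≤ᵇ n) ≡ false
≤ᵇ-≰ {m} {n} nle with m ≤ᵇ n | ≤ᵇ⇒≤ m n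
... | true | le = ⊥-elim (nle (le _))
... | false | _ = refl

shift-bool : ∀ a₀ a A → (a₀ + a ≡ᵇ A) ≡ ((a₀ ≤ᵇ A) ∧ (a ≡ᵇ A ∸ a₀))
shift-bool a₀ a A with a₀ ≤? A
... | no a₀≰A = trans (≡ᵇ-≢ λ e → a₀≰A (subst (a₀ ≤_) e (m≤m+n a₀ a)))
                      (sym (cong (_∧ (a ≡ᵇ A ∸ a₀)) (≤ᵇ-≰ a₀≰A)))
... | yes a₀≤A rewrite ≤ᵇ-≤ a₀≤A with a ≟ A ∸ a₀
...   | yes refl = trans (≡ᵇ-≡ (m+[n∸m]≡n a₀≤A)) (sym (≡ᵇ-refl (A ∸ a₀)))
...   | no ne = trans (≡ᵇ-≢ λ e → ne (trans (sym (m+n∸m≡n a₀ a)) (cong (_∸ a₀) e))) (sym (≡ᵇ-≢ ne))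

divmod-bool : ∀ P .{{_ : NonZero P}} y α →
  ((y % P ≡ᵇ P ∸ 1) ∧ (y / P ≡ᵇ α)) ≡ (y ≡ᵇ P ∸ 1 + α * P)
divmod-bool P y α with y ≟ P ∸ 1 + α * P
... | yes refl = trans (cong₂ _∧_ (≡ᵇ-≡ rem) (≡ᵇ-≡ quot)) (sym (≡ᵇ-refl (P ∸ 1 + α * P)))
  where
    P-1<P : P ∸ 1 < P
    P-1<P = pred< P
      where pred< : ∀ n .{{_ : NonZero n}} → n ∸ 1 < n
            pred< (suc n) = n<1+n n
    rem : (P ∸ 1 + α * P) % P ≡ P ∸ 1
    rem = trans ([m+kn]%n≡m%n (P ∸ 1) α P) (m<n⇒m%n≡m P-1<P)
    quot : (P ∸ 1 + α * P) / P ≡ α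
    quot = trans (+-distrib-/-∣ʳ (P ∸ 1) (divides α refl))
                 (cong₂ _+_ (m<n⇒m/n≡0 P-1<P) (m*n/n≡m α P))
... | no ne with y % P ≟ P ∸ 1 | y / P ≟ α
...   | yes e₁ | yes e₂ = ⊥-elim (ne (trans (m≡m%n+[m/n]*n y P) (cong₂ _+_ e₁ (cong (_* P) e₂))))
...   | no e₁ | _ rewrite ≡ᵇ-≢ e₁ = sym (≡ᵇ-≢ ne)
...   | yes e₁ | no e₂ rewrite ≡ᵇ-≡ e₁ | ≡ᵇ-≢ e₂ = sym (≡ᵇ-≢ ne)

coef : ℕ × Mono → Mono → ℕ
coef (c , a , b , e) (a' , b' , e') = if (a ≡ᵇ a') ∧ ((b ≡ᵇ b') ∧ (e ≡ᵇ e')) then c else 0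

rc-++ : ∀ P Q m → rawCoeff (P ++ Q) m ≡ rawCoeff P m + rawCoeff Q m
rc-++ [] Q m = refl
rc-++ (t ∷ P) Q m = trans (cong (coef t m +_) (rc-++ P Q m)) (sym (+-assoc (coef t m) _ _))

∧-shuffle : ∀ l₁ x₁ l₂ x₂ l₃ x₃ →
  ((l₁ ∧ x₁) ∧ ((l₂ ∧ x₂) ∧ (l₃ ∧ x₃))) ≡ ((l₁ ∧ (l₂ ∧ l₃)) ∧ (x₁ ∧ (x₂ ∧ x₃)))
∧-shuffle false _ _ _ _ _ = refl
∧-shuffle true x₁ false _ _ _ = ∧-zeroʳ x₁
∧-shuffle true x₁ true x₂ false _ = trans (cong (x₁ ∧_) (∧-zeroʳ x₂)) (∧-zeroʳ x₁)
∧-shuffle true x₁ true x₂ true x₃ = refl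

ite0 : ∀ b → (if b then 0 else 0) ≡ 0
ite0 false = refl
ite0 true = refl

if-if : ∀ A B (v : ℕ) → (if A then (if B then v else 0) else 0) ≡ (if A ∧ B then v else 0)
if-if false B v = refl
if-if true B v = refl

if-mul : ∀ d b c → d * (if b then c else 0) ≡ (if b then d * c else 0)
if-mul d false c = *-zeroʳ d
if-mul d true c = refl

if-+ : ∀ b x y → (if b then x else 0) + (if b then y else 0) ≡ (if b then x + y else 0)
if-+ false x y = refl
if-+ true x y = refl

fits : Mono → Mono → Bool
fits (a₀ , b₀ , e₀) (A , B , C) = (a₀ ≤ᵇ A) ∧ ((b₀ ≤ᵇ B) ∧ (e₀ ≤ᵇ C))

msub : Mono → Mono → Mono
msub (A , B , C) (a₀ , b₀ , e₀) = (A ∸ a₀ , B ∸ b₀ , C ∸ e₀)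

shiftC : ℕ × Mono → (Mono → ℕ) → Mono → ℕ
shiftC (d , μ₀) F m = if fits μ₀ m then d * F (msub m μ₀) else 0

coef-shift : ∀ s t m → coef (mulTerm s t) m ≡ shiftC s (coef t) m
coef-shift (d , a₀ , b₀ , e₀) (c , a , b , e) (A , B , C) =
  begin
    (if (a₀ + a ≡ᵇ A) ∧ ((b₀ + b ≡ᵇ B) ∧ (e₀ + e ≡ᵇ C)) then d * c else 0)
      ≡⟨ cong (λ z → if z then d * c else 0)
           (trans (cong₂ _∧_ (shift-bool a₀ a A) (cong₂ _∧_ (shift-bool b₀ b B) (shift-bool e₀ e C)))
                  (∧-shuffle (a₀ ≤ᵇ A) _ (b₀ ≤ᵇ B) _ (e₀ ≤ᵇ C) _)) ⟩
    (if L ∧ X then d * c else 0)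
      ≡⟨ sym (if-if L X (d * c)) ⟩
    (if L then (if X then d * c else 0) else 0)
      ≡⟨ cong (λ z → if L then z else 0) (sym (if-mul d X c)) ⟩
    (if L then d * (if X then c else 0) else 0) ∎
  where
    open ≡-Reasoning
    L = (a₀ ≤ᵇ A) ∧ ((b₀ ≤ᵇ B) ∧ (e₀ ≤ᵇ C))
    X = (a ≡ᵇ A ∸ a₀) ∧ ((b ≡ᵇ B ∸ b₀) ∧ (e ≡ᵇ C ∸ e₀))

rc-shift : ∀ s Q m → rawCoeff (map (mulTerm s) Q) m ≡ shiftC s (rawCoeff Q) m
rc-shift (d , μ₀) [] m = sym (trans (cong (λ z → if fits μ₀ m then z else 0) (*-zeroʳ d)) (ite0 (fits μ₀ m)))
rc-shift (d , μ₀) (t ∷ Q) m =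
  trans (cong₂ _+_ (coef-shift (d , μ₀) t m) (rc-shift (d , μ₀) Q m))
   (trans (if-+ (fits μ₀ m) _ _) (cong (λ z → if fits μ₀ m then z else 0) (sym (*-distribˡ-+ d _ _))))

shiftC-cong : ∀ s {F F'} → (∀ m → F m ≡ F' m) → ∀ m → shiftC s F m ≡ shiftC s F' m
shiftC-cong (d , μ₀) eq m = cong (λ z → if fits μ₀ m then d * z else 0) (eq (msub m μ₀))

shiftC-cong-p : ∀ p s {F F'} → (∀ m → ModEq p (F m) (F' m)) → ∀ m → ModEq p (shiftC s F m) (shiftC s F' m)
shiftC-cong-p p (d , μ₀) eq m = ≡p-if (fits μ₀ m) (≡p-*ˡ d (eq (msub m μ₀)))

infix 4 _≈_
record _≈_ (P Q : Poly) : Set where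
  constructor ≈i
  field ≈o : ∀ m → rawCoeff P m ≡ rawCoeff Q m
open _≈_ public

≈-refl : ∀ {P} → P ≈ P
≈-refl = ≈i λ m → refl

≈-sym : ∀ {P Q} → P ≈ Q → Q ≈ P
≈-sym e = ≈i λ m → sym (≈o e m)

≈-trans : ∀ {P Q R} → P ≈ Q → Q ≈ R → P ≈ R
≈-trans e₁ e₂ = ≈i λ m → trans (≈o e₁ m) (≈o e₂ m)

≡⇒≈ : ∀ {P Q} → P ≡ Q → P ≈ Q
≡⇒≈ refl = ≈-refl

≈i3 : ∀ {P Q} → (∀ A B C → rawCoeff P (A , B , C) ≡ rawCoeff Q (A , B , C)) → P ≈ Q
≈i3 F = ≈i λ where (A , B , C) → F A B C

swap4 : ∀ a b c d → (a + b) + (c + d) ≡ (a + c) + (b + d)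
swap4 = solve-∀

++-cong≈ : ∀ {P P' Q Q'} → P ≈ P' → Q ≈ Q' → (P ++ Q) ≈ (P' ++ Q')
++-cong≈ {P} {P'} {Q} {Q'} e₁ e₂ =
  ≈i λ m → trans (rc-++ P Q m) (trans (cong₂ _+_ (≈o e₁ m) (≈o e₂ m)) (sym (rc-++ P' Q' m)))

++-comm≈ : ∀ P Q → (P ++ Q) ≈ (Q ++ P)
++-comm≈ P Q = ≈i λ m → trans (rc-++ P Q m) (trans (+-comm (rawCoeff P m) _) (sym (rc-++ Q P m)))

mulP-[]ʳ : ∀ P → mulP P [] ≡ []
mulP-[]ʳ [] = refl
mulP-[]ʳ (s ∷ P) = mulP-[]ʳ P

mulP-++ˡ : ∀ P P' Q → mulP (P ++ P') Q ≡ mulP P Q ++ mulP P' Q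
mulP-++ˡ [] P' Q = refl
mulP-++ˡ (s ∷ P) P' Q =
  trans (cong (map (mulTerm s) Q ++_) (mulP-++ˡ P P' Q)) (sym (LP.++-assoc (map (mulTerm s) Q) _ _))

mulTerm-assoc : ∀ s t u → mulTerm (mulTerm s t) u ≡ mulTerm s (mulTerm t u)
mulTerm-assoc (c , a , b , e) (c' , a' , b' , e') (c'' , a'' , b'' , e'') =
  cong₂ _,_ (*-assoc c c' c'') (cong₂ _,_ (+-assoc a a' a'') (cong₂ _,_ (+-assoc b b' b'') (+-assoc e e' e'')))

mulTerm-comm : ∀ s t → mulTerm s t ≡ mulTerm t s
mulTerm-comm (c , a , b , e) (c' , a' , b' , e') =
  cong₂ _,_ (*-comm c c') (cong₂ _,_ (+-comm a a') (cong₂ _,_ (+-comm b b') (+-comm e e')))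

map-mulP : ∀ s Q R → mulP (map (mulTerm s) Q) R ≡ map (mulTerm s) (mulP Q R)
map-mulP s [] R = refl
map-mulP s (t ∷ Q) R =
  trans (cong₂ _++_ (trans (LP.map-cong (mulTerm-assoc s t) R) (LP.map-∘ R)) (map-mulP s Q R))
        (sym (LP.map-++ (mulTerm s) (map (mulTerm t) R) (mulP Q R)))

mulP-assoc : ∀ P Q R → mulP (mulP P Q) R ≡ mulP P (mulP Q R)
mulP-assoc [] Q R = refl
mulP-assoc (s ∷ P) Q R =
  trans (mulP-++ˡ (map (mulTerm s) Q) (mulP P Q) R) (cong₂ _++_ (map-mulP s Q R) (mulP-assoc P Q R))

rc-mulP-∷ : ∀ s P Q m → rawCoeff (mulP (s ∷ P) Q) m ≡ rawCoeff (map (mulTerm s) Q) m + rawCoeff (mulP P Q) m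
rc-mulP-∷ s P Q m = rc-++ (map (mulTerm s) Q) (mulP P Q) m

rc-mulP-∷ʳ : ∀ s P Q m →
  rawCoeff (mulP Q (s ∷ P)) m ≡ rawCoeff (map (λ t → mulTerm t s) Q) m + rawCoeff (mulP Q P) m
rc-mulP-∷ʳ s P [] m = refl
rc-mulP-∷ʳ s P (t ∷ Q) m =
  begin
    rawCoeff (mulP (t ∷ Q) (s ∷ P)) m
      ≡⟨ rc-++ (mulTerm t s ∷ map (mulTerm t) P) (mulP Q (s ∷ P)) m ⟩
    (c₀ + x) + rawCoeff (mulP Q (s ∷ P)) m
      ≡⟨ cong ((c₀ + x) +_) (rc-mulP-∷ʳ s P Q m) ⟩
    (c₀ + x) + (y + z)
      ≡⟨ swap4 c₀ x y z ⟩
    (c₀ + y) + (x + z)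
      ≡⟨ cong ((c₀ + y) +_) (sym (rc-++ (map (mulTerm t) P) (mulP Q P) m)) ⟩
    rawCoeff (map (λ t → mulTerm t s) (t ∷ Q)) m + rawCoeff (mulP (t ∷ Q) P) m ∎
  where
    open ≡-Reasoning
    c₀ = coef (mulTerm t s) m
    x = rawCoeff (map (mulTerm t) P) m
    y = rawCoeff (map (λ t → mulTerm t s) Q) m
    z = rawCoeff (mulP Q P) m

mulP-comm≈ : ∀ P Q → mulP P Q ≈ mulP Q P
mulP-comm≈ P Q = ≈i (comm P)
  where
    comm : ∀ P m → rawCoeff (mulP P Q) m ≡ rawCoeff (mulP Q P) m
    comm [] m = cong (λ z → rawCoeff z m) (sym (mulP-[]ʳ Q))
    comm (s ∷ P) m =
      trans (rc-mulP-∷ s P Q m)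
       (trans (cong₂ _+_ (cong (λ z → rawCoeff z m) (LP.map-cong (mulTerm-comm s) Q)) (comm P m))
         (sym (rc-mulP-∷ʳ s P Q m)))

mulP-congʳ : ∀ P {Q Q'} → Q ≈ Q' → mulP P Q ≈ mulP P Q'
mulP-congʳ P {Q} {Q'} e = ≈i (go P)
  where
    go : ∀ P m → rawCoeff (mulP P Q) m ≡ rawCoeff (mulP P Q') m
    go [] m = refl
    go (s ∷ P) m =
      trans (rc-mulP-∷ s P Q m)
        (trans (cong₂ _+_ (trans (rc-shift s Q m) (trans (shiftC-cong s (≈o e) m) (sym (rc-shift s Q' m)))) (go P m))
          (sym (rc-mulP-∷ s P Q' m)))

mulP-cong≈ : ∀ {P P' Q Q'} → P ≈ P' → Q ≈ Q' → mulP P Q ≈ mulP P' Q'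
mulP-cong≈ {P} {P'} {Q} {Q'} e₁ e₂ =
  ≈-trans (mulP-congʳ P e₂) (≈-trans (mulP-comm≈ P Q') (≈-trans (mulP-congʳ Q' e₁) (mulP-comm≈ Q' P')))

mulP-oneˡ : ∀ Q → mulP oneP Q ≈ Q
mulP-oneˡ Q = ≈i λ m → trans (rc-++ (map (mulTerm (1 , 0 , 0 , 0)) Q) [] m)
  (trans (+-identityʳ _) (trans (rc-shift (1 , 0 , 0 , 0) Q m) (+-identityʳ _)))

-- k[x,y,z] (up to exact coefficient equality) is a commutative semiring;
-- this lets us use the library's binomial theorem and laws of powers.
PolyCS : CommutativeSemiring 0ℓ 0ℓ
PolyCS = record
  { Carrier = Poly ; _≈_ = _≈_ ; _+_ = _++_ ; _*_ = mulP ; 0# = [] ; 1# = oneP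
  ; isCommutativeSemiring = Biased.isCommutativeSemiringˡ (record
     { +-isCommutativeMonoid = record
        { isMonoid = record
           { isSemigroup = record
              { isMagma = record { isEquivalence = eqv ; ∙-cong = ++-cong≈ }
              ; assoc = λ x y z → ≡⇒≈ (LP.++-assoc x y z) }
           ; identity = (λ x → ≈-refl) , (λ x → ≡⇒≈ (LP.++-identityʳ x)) }
        ; comm = ++-comm≈ }
     ; *-isCommutativeMonoid = record
        { isMonoid = record
           { isSemigroup = record
              { isMagma = record { isEquivalence = eqv ; ∙-cong = mulP-cong≈ }
              ; assoc = λ x y z → ≡⇒≈ (mulP-assoc x y z) }
           ; identity = mulP-oneˡ , (λ x → ≈-trans (mulP-comm≈ x oneP) (mulP-oneˡ x)) }
        ; comm = mulP-comm≈ }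
     ; distribʳ = λ x y z → ≡⇒≈ (mulP-++ˡ y z x)
     ; zeroˡ = λ x → ≈-refl })
  }
  where
    eqv : IsEquivalence _≈_
    eqv = record { refl = ≈-refl ; sym = ≈-sym ; trans = ≈-trans }

module PS = CommutativeSemiring PolyCS
open import Algebra.Properties.Semiring.Exp PS.semiring using () renaming (_^_ to _^S_)
open import Algebra.Properties.Semiring.Mult PS.semiring using () renaming (_×_ to _×S_)
open import Algebra.Properties.Monoid.Sum PS.+-monoid using (sum)
open import Algebra.Properties.CommutativeSemiring.Binomial PolyCS using (theorem; binomialTerm)
import Algebra.Properties.Semiring.Exp PS.semiring as PExp
import Algebra.Properties.CommutativeSemiring.Exp PolyCS as PCExp

pow≡ : ∀ X n → X ^S n ≡ powP X n
pow≡ X zero = refl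
pow≡ X (suc n) = cong (mulP X) (pow≡ X n)

rc-× : ∀ n Z m → rawCoeff (n ×S Z) m ≡ n * rawCoeff Z m
rc-× zero Z m = refl
rc-× (suc n) Z m = trans (rc-++ Z (n ×S Z) m) (cong (rawCoeff Z m +_) (rc-× n Z m))

powP-*-assoc : ∀ X m n → powP X (m * n) ≈ powP (powP X m) n
powP-*-assoc X m n = ≈-trans (≡⇒≈ (sym (pow≡ X (m * n))))
  (≈-trans (≈-sym (PExp.^-assocʳ X m n)) (≡⇒≈ (trans (pow≡ (X ^S m) n) (cong (λ z → powP z n) (pow≡ X m)))))

powP-distrib : ∀ X Y n → powP (mulP X Y) n ≈ mulP (powP X n) (powP Y n)
powP-distrib X Y n = ≈-trans (≡⇒≈ (sym (pow≡ (mulP X Y) n)))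
  (≈-trans (PCExp.^-distrib-* X Y n) (≡⇒≈ (cong₂ mulP (pow≡ X n) (pow≡ Y n))))

pow-term : ∀ c a b e n → powP ((c , a , b , e) ∷ []) n ≈ ((c ^ n , n * a , n * b , n * e) ∷ [])
pow-term c a b e zero = ≈-refl
pow-term c a b e (suc n) = mulP-cong≈ {P = (c , a , b , e) ∷ []} ≈-refl (pow-term c a b e n)

module ModP (p : ℕ) where
  infix 4 _≈p_
  record _≈p_ (P Q : Poly) : Set where
    constructor ≈pi
    field ≈po : PolyEq p P Q
  open _≈p_ public

  ≈p-refl : ∀ {P} → P ≈p P
  ≈p-refl = ≈pi λ m → ≡p-refl

  ≈p-sym : ∀ {P Q} → P ≈p Q → Q ≈p P
  ≈p-sym e = ≈pi λ m → ≡p-sym (≈po e m)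

  ≈p-trans : ∀ {P Q R} → P ≈p Q → Q ≈p R → P ≈p R
  ≈p-trans e₁ e₂ = ≈pi λ m → ≡p-trans (≈po e₁ m) (≈po e₂ m)

  ≈⇒≈p : ∀ {P Q} → P ≈ Q → P ≈p Q
  ≈⇒≈p e = ≈pi λ m → ≡p-≡ (≈o e m)

  ++-cong≈p : ∀ {P P' Q Q'} → P ≈p P' → Q ≈p Q' → (P ++ Q) ≈p (P' ++ Q')
  ++-cong≈p {P} {P'} {Q} {Q'} e₁ e₂ = ≈pi λ m →
    ≡p-trans (≡p-≡ (rc-++ P Q m)) (≡p-trans (≡p-+ (≈po e₁ m) (≈po e₂ m)) (≡p-≡ (sym (rc-++ P' Q' m))))

  mulP-congʳ≈p : ∀ P {Q Q'} → Q ≈p Q' → mulP P Q ≈p mulP P Q'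
  mulP-congʳ≈p P {Q} {Q'} e = ≈pi (go P)
    where
      go : ∀ P → PolyEq p (mulP P Q) (mulP P Q')
      go [] m = ≡p-refl
      go (s ∷ P) m =
        ≡p-trans (≡p-≡ (rc-mulP-∷ s P Q m))
          (≡p-trans (≡p-+ (≡p-trans (≡p-≡ (rc-shift s Q m))
                            (≡p-trans (shiftC-cong-p p s (≈po e) m) (≡p-≡ (sym (rc-shift s Q' m)))))
                          (go P m))
            (≡p-≡ (sym (rc-mulP-∷ s P Q' m))))

  mulP-cong≈p : ∀ {P P' Q Q'} → P ≈p P' → Q ≈p Q' → mulP P Q ≈p mulP P' Q'
  mulP-cong≈p {P} {P'} {Q} {Q'} e₁ e₂ =
    ≈p-trans (mulP-congʳ≈p P e₂) (≈p-trans (≈⇒≈p (mulP-comm≈ P Q'))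
      (≈p-trans (mulP-congʳ≈p Q' e₁) (≈⇒≈p (mulP-comm≈ Q' P'))))

  powP-cong≈p : ∀ {P P'} n → P ≈p P' → powP P n ≈p powP P' n
  powP-cong≈p zero e = ≈p-refl
  powP-cong≈p (suc n) e = mulP-cong≈p e (powP-cong≈p n e)

prime≡2+ : ∀ {p} → Prime p → Σ ℕ λ q → p ≡ suc (suc q)
prime≡2+ {zero} pp with prime⇒nonTrivial pp
... | ()
prime≡2+ {suc zero} pp with prime⇒nonTrivial pp
... | ()
prime≡2+ {suc (suc q)} pp = q , refl

prime∤factorial : ∀ {p} → Prime p → ∀ m → m < p → ¬ (p ∣ m !)
prime∤factorial {p} pp zero m<p d with prime≡2+ pp
... | q , refl with ∣⇒≤ d
... | s≤s ()
prime∤factorial {p} pp (suc m) m<p d with euclidsLemma (suc m) (m !) pp d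
... | inj₁ d₁ = <⇒≱ m<p (∣⇒≤ d₁)
... | inj₂ d₂ = prime∤factorial pp m (<-trans (n<1+n m) m<p) d₂

prime∣binomial : ∀ {p} → Prime p → ∀ k → 0 < k → k < p → Σ ℕ λ m → binom p k ≡ p * m
prime∣binomial {p} pp k 0<k k<p with euclidsLemma (binom p k) X pp p∣CX
  where
    instance _ = k !* (p ∸ k) !≢0
    X = k ! * (p ∸ k) !
    CX≡p! : (binom p k) * X ≡ p !
    CX≡p! = trans (cong (_* X) (nCk≡n!/k![n-k]! (<⇒≤ k<p))) (m/n*n≡m (k![n∸k]!∣n! (<⇒≤ k<p)))
    p∣p! : p ∣ p !
    p∣p! with prime≡2+ pp
    ... | q , refl = m∣m*n ((suc q) !)
    p∣CX : p ∣ (binom p k) * X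
    p∣CX = subst (p ∣_) (sym CX≡p!) p∣p!
... | inj₁ (divides m eq) = m , trans eq (*-comm m p)
... | inj₂ d with euclidsLemma (k !) ((p ∸ k) !) pp d
...   | inj₁ d₁ = ⊥-elim (prime∤factorial pp k k<p d₁)
...   | inj₂ d₂ = ⊥-elim (prime∤factorial pp (p ∸ k) (∸-monoʳ-< {p} {k} {0} 0<k (<⇒≤ k<p)) d₂)

module ℕFrobenius = FrobeniusBinomial +-*-commutativeSemiring
open import Algebra.Properties.Semiring.Exp (CommutativeSemiring.semiring +-*-commutativeSemiring) using () renaming (_^_ to _^ℕ_)
open import Algebra.Properties.Semiring.Mult (CommutativeSemiring.semiring +-*-commutativeSemiring) using () renaming (_×_ to _×ℕ_)

^ℕ≡^ : ∀ c n → c ^ℕ n ≡ c ^ n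
^ℕ≡^ c zero = refl
^ℕ≡^ c (suc n) = cong (c *_) (^ℕ≡^ c n)

×ℕ≡* : ∀ n z → n ×ℕ z ≡ n * z
×ℕ≡* zero z = refl
×ℕ≡* (suc n) z = cong (z +_) (×ℕ≡* n z)

-- Fermat's little theorem, by induction on c using (c + 1)^p ≡ c^p + 1.
fermat : ∀ {p} → Prime p → ∀ c → ModEq p (c ^ p) c
fermat {p} pp c with prime≡2+ pp
... | q , refl = go c
  where
    go : ∀ c → ModEq p (c ^ p) c
    go zero = ≡p-refl
    go (suc c) = ≡p-trans (≡p-≡ expand) (≡p-trans (≡p-drop _ z) (≡p-trans (≡p-+ (go c) (≡p-≡ (^-zeroˡ p))) (≡p-≡ (+-comm c 1))))
      where
        step = ℕFrobenius.frobenius-binomial q (prime∣binomial pp) c 1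
        z = proj₁ step
        expand : suc c ^ p ≡ (c ^ p + 1 ^ p) + p * z
        expand = trans (cong (_^ p) (+-comm 1 c)) (trans (sym (^ℕ≡^ (c + 1) p)) (trans (proj₂ step)
                  (cong₂ _+_ (cong₂ _+_ (^ℕ≡^ c p) (^ℕ≡^ 1 p)) (×ℕ≡* p z))))

frTerm : ℕ → ℕ × Mono → ℕ × Mono
frTerm k (c , a , b , e) = (c , k * a , k * b , k * e)

Fr : ℕ → Poly → Poly
Fr k X = map (frTerm k) X

Fr-Fr : ∀ k l X → Fr k (Fr l X) ≡ Fr (l * k) X
Fr-Fr k l X = trans (sym (LP.map-∘ X)) (LP.map-cong twice X)
  where
    reassoc : ∀ x → k * (l * x) ≡ l * k * x
    reassoc x = trans (sym (*-assoc k l x)) (cong (_* x) (*-comm k l))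
    twice : ∀ t → frTerm k (frTerm l t) ≡ frTerm (l * k) t
    twice (c , a , b , e) = cong₂ _,_ refl (cong₂ _,_ (reassoc a) (cong₂ _,_ (reassoc b) (reassoc e)))

Fr-1 : ∀ X → Fr 1 X ≡ X
Fr-1 X = trans (LP.map-cong once X) (LP.map-id X)
  where once : ∀ t → frTerm 1 t ≡ t
        once (c , a , b , e) = cong₂ _,_ refl (cong₂ _,_ (+-identityʳ a) (cong₂ _,_ (+-identityʳ b) (+-identityʳ e)))

module Frobenius (p : ℕ) (pp : Prime p) where
  open ModP p

  term-cong-p : ∀ {c c'} m → ModEq p c c' → ((c , m) ∷ []) ≈p ((c' , m) ∷ [])
  term-cong-p {c} {c'} (a , b , e) eq = ≈pi (λ where (A , B , C) → lem ((a ≡ᵇ A) ∧ ((b ≡ᵇ B) ∧ (e ≡ᵇ C))))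
    where
      lem : ∀ B → ModEq p ((if B then c else 0) + 0) ((if B then c' else 0) + 0)
      lem B = ≡p-+ (≡p-if B eq) ≡p-refl

  drop-× : ∀ A z → (A ++ (p ×S z)) ≈p A
  drop-× A z = ≈pi λ m → ≡p-trans (≡p-≡ (trans (rc-++ A (p ×S z) m) (cong (rawCoeff A m +_) (rc-× p z m))))
                                  (≡p-drop (rawCoeff A m) (rawCoeff z m))

  -- X^p ≡ Fr_p(X), term by term: (t + X)^p ≡ t^p + X^p and c^p ≡ c.
  frobenius₁ : ∀ X → powP X p ≈p Fr p X
  frobenius₁ X with prime≡2+ pp
  ... | q , refl = go X
    where
      go : ∀ X → powP X p ≈p Fr p X
      go [] = ≈p-refl
      go ((c , a , b , e) ∷ X) =
        ≈p-trans (≈⇒≈p (≈-trans (≡⇒≈ (sym (pow≡ ((c , a , b , e) ∷ X) p))) (proj₂ step)))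
         (≈p-trans (drop-× _ (proj₁ step))
          (++-cong≈p (≈p-trans (≈⇒≈p (≈-trans (≡⇒≈ (pow≡ _ p)) (pow-term c a b e p)))
                               (term-cong-p (p * a , p * b , p * e) (fermat pp c)))
                     (≈p-trans (≈⇒≈p (≡⇒≈ (pow≡ X p))) (go X))))
        where
          module PolyFrobenius = FrobeniusBinomial PolyCS
          step = PolyFrobenius.frobenius-binomial q (prime∣binomial pp) ((c , a , b , e) ∷ []) X

  frobenius : ∀ r X → powP X (p ^ r) ≈p Fr (p ^ r) X
  frobenius zero X = ≈⇒≈p (≈-trans (mulP-comm≈ X oneP) (≈-trans (mulP-oneˡ X) (≡⇒≈ (sym (Fr-1 X)))))
  frobenius (suc r) X =
    ≈p-trans (≈⇒≈p (powP-*-assoc X p (p ^ r)))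
     (≈p-trans (powP-cong≈p (p ^ r) (frobenius₁ X))
      (≈p-trans (frobenius r (Fr p X)) (≈⇒≈p (≡⇒≈ (Fr-Fr (p ^ r) p X)))))

-- Thus E(Q) is the R^P-coefficient of Q at the basis monomial
-- x^(P-1-mx) y^(P-1-my) z^(P-1-mz).
divmod-shift : ∀ P .{{_ : NonZero P}} x x' m →
  ((x + P * x' + m) % P ≡ (x + m) % P) × ((x + P * x' + m) / P ≡ (x + m) / P + x')
divmod-shift P x x' m =
  trans (cong (_% P) rearrange) ([m+kn]%n≡m%n (x + m) x' P) ,
  trans (cong (_/ P) rearrange)
        (trans (+-distrib-/-∣ʳ (x + m) (divides x' refl)) (cong ((x + m) / P +_) (m*n/n≡m x' P)))
  where
    rearrange : x + P * x' + m ≡ x + m + x' * P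
    rearrange = solve (x ∷ x' ∷ m ∷ P ∷ [])

module Extraction (P : ℕ) .{{_ : NonZero P}} (mx my mz : ℕ) where

  selected : ℕ × Mono → Bool
  selected (c , a , b , e) = ((a + mx) % P ≡ᵇ P ∸ 1) ∧ (((b + my) % P ≡ᵇ P ∸ 1) ∧ ((e + mz) % P ≡ᵇ P ∸ 1))

  quotient : ℕ × Mono → ℕ × Mono
  quotient (c , a , b , e) = (c , (a + mx) / P , (b + my) / P , (e + mz) / P)

  keepIf : Bool → ℕ × Mono → Poly
  keepIf true t = quotient t ∷ []
  keepIf false t = []

  Eterm : ℕ × Mono → Poly
  Eterm t = keepIf (selected t) t

  E : Poly → Poly
  E Q = concatMap Eterm Q

  E-++ : ∀ X Y → E (X ++ Y) ≡ E X ++ E Y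
  E-++ [] Y = refl
  E-++ (t ∷ X) Y = trans (cong (Eterm t ++_) (E-++ X Y)) (sym (LP.++-assoc (Eterm t) (E X) (E Y)))

  -- The monomial of Q · x^mx y^my z^mz read off at (α, β, γ).
  lift : Mono → Mono
  lift (α , β , γ) = (P ∸ 1 + α * P , P ∸ 1 + β * P , P ∸ 1 + γ * P)

  offset : ℕ × Mono
  offset = (1 , mx , my , mz)

  rc-Eterm : ∀ t μ → rawCoeff (Eterm t) μ ≡ coef (mulTerm offset t) (lift μ)
  rc-Eterm (c , a , b , e) (α , β , γ) =
    begin
      rawCoeff (keepIf M (c , a , b , e)) (α , β , γ)
        ≡⟨ keep M ⟩
      (if M ∧ O then c else 0)
        ≡⟨ cong (λ z → if z then c else 0) (sym (∧-shuffle m₁ o₁ m₂ o₂ m₃ o₃)) ⟩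
      (if (m₁ ∧ o₁) ∧ ((m₂ ∧ o₂) ∧ (m₃ ∧ o₃)) then c else 0)
        ≡⟨ cong (λ z → if z then c else 0) (cong₂ _∧_ (digit a mx α) (cong₂ _∧_ (digit b my β) (digit e mz γ))) ⟩
      (if (mx + a ≡ᵇ Ka) ∧ ((my + b ≡ᵇ Kb) ∧ (mz + e ≡ᵇ Kc)) then c else 0)
        ≡⟨ cong (λ z → if (mx + a ≡ᵇ Ka) ∧ ((my + b ≡ᵇ Kb) ∧ (mz + e ≡ᵇ Kc)) then z else 0) (sym (*-identityˡ c)) ⟩
      coef (mulTerm offset (c , a , b , e)) (lift (α , β , γ)) ∎
    where
      open ≡-Reasoning
      Ka = P ∸ 1 + α * P
      Kb = P ∸ 1 + β * P
      Kc = P ∸ 1 + γ * P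
      m₁ = (a + mx) % P ≡ᵇ P ∸ 1
      m₂ = (b + my) % P ≡ᵇ P ∸ 1
      m₃ = (e + mz) % P ≡ᵇ P ∸ 1
      o₁ = (a + mx) / P ≡ᵇ α
      o₂ = (b + my) / P ≡ᵇ β
      o₃ = (e + mz) / P ≡ᵇ γ
      M = m₁ ∧ (m₂ ∧ m₃)
      O = o₁ ∧ (o₂ ∧ o₃)
      keep : ∀ B → rawCoeff (keepIf B (c , a , b , e)) (α , β , γ) ≡ (if B ∧ O then c else 0)
      keep true = +-identityʳ _
      keep false = refl
      digit : ∀ x m κ → (((x + m) % P ≡ᵇ P ∸ 1) ∧ ((x + m) / P ≡ᵇ κ)) ≡ (m + x ≡ᵇ P ∸ 1 + κ * P)
      digit x m κ = trans (divmod-bool P (x + m) κ) (cong (_≡ᵇ P ∸ 1 + κ * P) (+-comm x m))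

  rc-E : ∀ Q μ → rawCoeff (E Q) μ ≡ shiftC offset (rawCoeff Q) (lift μ)
  rc-E Q μ = trans (go Q) (rc-shift offset Q (lift μ))
    where
      go : ∀ Q → rawCoeff (E Q) μ ≡ rawCoeff (map (mulTerm offset) Q) (lift μ)
      go [] = refl
      go (t ∷ Q) = trans (rc-++ (Eterm t) (E Q) μ) (cong₂ _+_ (rc-Eterm t μ) (go Q))

  E-cong-p : ∀ p {X Y} → ModP._≈p_ p X Y → ModP._≈p_ p (E X) (E Y)
  E-cong-p p {X} {Y} e = ModP.≈pi λ μ →
    ≡p-trans (≡p-≡ (rc-E X μ)) (≡p-trans (shiftC-cong-p p offset (ModP.≈po e) (lift μ)) (≡p-≡ (sym (rc-E Y μ))))

  selected-fr : ∀ s t → selected (mulTerm s (frTerm P t)) ≡ selected s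
  selected-fr (c , a , b , e) (c' , a' , b' , e') =
    cong₂ _∧_ (digit a a' mx) (cong₂ _∧_ (digit b b' my) (digit e e' mz))
    where
      digit : ∀ x x' m → ((x + P * x' + m) % P ≡ᵇ P ∸ 1) ≡ ((x + m) % P ≡ᵇ P ∸ 1)
      digit x x' m = cong (_≡ᵇ P ∸ 1) (proj₁ (divmod-shift P x x' m))

  quotient-fr : ∀ s t → quotient (mulTerm s (frTerm P t)) ≡ mulTerm (quotient s) t
  quotient-fr (c , a , b , e) (c' , a' , b' , e') =
    cong₂ _,_ refl (cong₂ _,_ (quot a a' mx) (cong₂ _,_ (quot b b' my) (quot e e' mz)))
    where quot : ∀ x x' m → (x + P * x' + m) / P ≡ (x + m) / P + x'
          quot x x' m = proj₂ (divmod-shift P x x' m)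

  scaleIf : Bool → ℕ × Mono → Poly → Poly
  scaleIf true s T = map (mulTerm (quotient s)) T
  scaleIf false s T = []

  E-term-fr : ∀ s T → E (map (mulTerm s) (Fr P T)) ≡ scaleIf (selected s) s T
  E-term-fr s [] with selected s
  ... | true = refl
  ... | false = refl
  E-term-fr s (t ∷ T) rewrite selected-fr s t | E-term-fr s T with selected s
  ... | true = cong (_∷ map (mulTerm (quotient s)) T) (quotient-fr s t)
  ... | false = refl

  Eterm-mul : ∀ s T → mulP (Eterm s) T ≡ scaleIf (selected s) s T
  Eterm-mul s T with selected s
  ... | true = LP.++-identityʳ _
  ... | false = refl

  E-frob : ∀ S T → E (mulP S (Fr P T)) ≡ mulP (E S) T
  E-frob [] T = refl
  E-frob (s ∷ S) T = trans (E-++ (map (mulTerm s) (Fr P T)) (mulP S (Fr P T)))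
    (trans (cong₂ _++_ (trans (E-term-fr s T) (sym (Eterm-mul s T))) (E-frob S T))
           (sym (mulP-++ˡ (Eterm s) (E S) T)))

-- The key ideal-theoretic fact: if q ∈ J^[p^r] then E(q) ∈ J, so E(q) lies
-- in I_r(q).  (E(Σ sᵢ tᵢ^(p^r)) ≡ Σ E(sᵢ) tᵢ by Frobenius and E-frob.)
module _ (p : ℕ) (pp : Prime p) (r : ℕ) (mx my mz : ℕ) where
  private
    instance
      nzP : NonZero (p ^ r)
      nzP = m^n≢0 p r {{prime⇒nonZero pp}}
  open Extraction (p ^ r) mx my mz
  open ModP p
  open Frobenius p pp

  E∈I : ∀ q → InI p r q (E q)
  E∈I q J isI (gens , allJ , qeq) =
    IsIdeal.respects isI (≈po (E-cong-p p {sumP (map F gens)} {q} (≈p-sym (≈pi qeq)))) (go gens allJ)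
    where
      F : Poly × Poly → Poly
      F st = mulP (proj₁ st) (powP (proj₂ st) (p ^ r))
      go : ∀ gs → All (λ st → J (proj₂ st)) gs → J (E (sumP (map F gs)))
      go [] All.[] = IsIdeal.zero∈ isI
      go ((a , b) ∷ gs) (jb All.∷ js) = subst J (sym (E-++ (F (a , b)) (sumP (map F gs))))
        (IsIdeal.+-closed isI
          (IsIdeal.respects isI (≈po (≈p-trans (≈⇒≈p (≡⇒≈ (sym (E-frob a b))))
               (E-cong-p p {mulP a (Fr (p ^ r) b)} {F (a , b)} (mulP-cong≈p (≈p-refl {a}) (≈p-sym (frobenius r b))))))
             (IsIdeal.*-closed isI (E a) jb))
          (go gs js))

module Grading (deg : ℕ × Mono → ℕ) (deg-mul : ∀ s t → deg (mulTerm s t) ≡ deg s + deg t) where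
  All-map-mul : ∀ {d₁ d₂} s Q → deg s ≡ d₁ → All (λ t → deg t ≡ d₂) Q →
                All (λ t → deg t ≡ d₁ + d₂) (map (mulTerm s) Q)
  All-map-mul s [] e All.[] = All.[]
  All-map-mul s (t ∷ Q) e (et All.∷ eQ) = trans (deg-mul s t) (cong₂ _+_ e et) All.∷ All-map-mul s Q e eQ

  All-mulP : ∀ {d₁ d₂} P Q → All (λ t → deg t ≡ d₁) P → All (λ t → deg t ≡ d₂) Q →
             All (λ t → deg t ≡ d₁ + d₂) (mulP P Q)
  All-mulP [] Q All.[] eQ = All.[]
  All-mulP (s ∷ P) Q (es All.∷ eP) eQ = AP.++⁺ (All-map-mul s Q es eQ) (All-mulP P Q eP eQ)

  All-powP : ∀ {d} P n → deg (1 , 0 , 0 , 0) ≡ 0 → All (λ t → deg t ≡ d) P →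
             All (λ t → deg t ≡ n * d) (powP P n)
  All-powP P zero e₀ eP = e₀ All.∷ All.[]
  All-powP P (suc n) e₀ eP = All-mulP P (powP P n) eP (All-powP P n e₀ eP)

rc-All0 : ∀ (R : ℕ × Mono → Set) m → (∀ t → R t → coef t m ≡ 0) → ∀ X → All R X → rawCoeff X m ≡ 0
rc-All0 R m f [] All.[] = refl
rc-All0 R m f (t ∷ X) (rt All.∷ rX) = cong₂ _+_ (f t rt) (rc-All0 R m f X rX)

xdeg ydeg hdeg : ℕ × Mono → ℕ
xdeg (c , a , b , e) = a
ydeg (c , a , b , e) = b
-- degree in x and z together: the grading for which h(x,z) is homogeneous
hdeg (c , a , b , e) = a + e

xdeg-mul : ∀ s t → xdeg (mulTerm s t) ≡ xdeg s + xdeg t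
xdeg-mul (c , a , b , e) (c' , a' , b' , e') = refl

ydeg-mul : ∀ s t → ydeg (mulTerm s t) ≡ ydeg s + ydeg t
ydeg-mul (c , a , b , e) (c' , a' , b' , e') = refl

hdeg-mul : ∀ s t → hdeg (mulTerm s t) ≡ hdeg s + hdeg t
hdeg-mul (c , a , b , e) (c' , a' , b' , e') = swap4 a a' e e'

coef-ydeg : ∀ {d} t A B C → ydeg t ≡ d → B ≢ d → coef t (A , B , C) ≡ 0
coef-ydeg (c , a , b , e) A B C refl ne with b ≟ B
... | yes refl = ⊥-elim (ne refl)
... | no nb rewrite ≡ᵇ-≢ nb with a ≡ᵇ A
...   | true = refl
...   | false = refl

coef-xdeg≡ : ∀ {d} t A B C → xdeg t ≡ d → A ≢ d → coef t (A , B , C) ≡ 0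
coef-xdeg≡ (c , a , b , e) A B C refl ne rewrite ≡ᵇ-≢ {a} {A} (λ x → ne (sym x)) = refl

coef-xdeg≤ : ∀ {d} t A B C → xdeg t ≤ d → d < A → coef t (A , B , C) ≡ 0
coef-xdeg≤ (c , a , b , e) A B C le lt rewrite ≡ᵇ-≢ {a} {A} (λ eq → <⇒≱ lt (subst (_≤ _) eq le)) = refl

xsh : ℕ × Mono → ℕ × Mono
xsh (c , a , b , e) = (c , suc a , b , e)

rc-xsh-0 : ∀ X B C → rawCoeff (map xsh X) (0 , B , C) ≡ 0
rc-xsh-0 [] B C = refl
rc-xsh-0 ((c , a , b , e) ∷ X) B C = rc-xsh-0 X B C

rc-xsh-s : ∀ X A B C → rawCoeff (map xsh X) (suc A , B , C) ≡ rawCoeff X (A , B , C)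
rc-xsh-s [] A B C = refl
rc-xsh-s ((c , a , b , e) ∷ X) A B C = cong (coef (c , a , b , e) (A , B , C) +_) (rc-xsh-s X A B C)

xsh-mul : ∀ X → mulP ((1 , 1 , 0 , 0) ∷ []) X ≡ map xsh X
xsh-mul X = trans (LP.++-identityʳ _) (LP.map-cong times-x X)
  where times-x : ∀ t → mulTerm (1 , 1 , 0 , 0) t ≡ xsh t
        times-x (c , a , b , e) = cong (λ z → (z , suc a , b , e)) (+-identityʳ c)

rc-upTo : ∀ n (F G : ℕ → ℕ) A B C →
  rawCoeff (map (λ i → (F i , i , 0 , G i)) (upTo n)) (A , B , C)
    ≡ (if (A <ᵇ n) ∧ ((0 ≡ᵇ B) ∧ (G A ≡ᵇ C)) then F A else 0)
rc-upTo n F G A B C =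
  trans (cong (λ z → rawCoeff z (A , B , C)) (LP.map-applyUpTo (λ i → i) (λ i → (F i , i , 0 , G i)) n))
        (go n F G A)
  where
    go : ∀ n (F G : ℕ → ℕ) A →
      rawCoeff (applyUpTo (λ i → (F i , i , 0 , G i)) n) (A , B , C)
        ≡ (if (A <ᵇ n) ∧ ((0 ≡ᵇ B) ∧ (G A ≡ᵇ C)) then F A else 0)
    go zero F G A = refl
    go (suc n) F G A =
      trans (cong (λ z → coef (F 0 , 0 , 0 , G 0) (A , B , C) + rawCoeff z (A , B , C))
              (sym (LP.map-applyUpTo (λ i → (F (suc i) , i , 0 , G (suc i))) xsh n)))
            (split A)
      where
        Xs = applyUpTo (λ i → (F (suc i) , i , 0 , G (suc i))) n
        split : ∀ A → coef (F 0 , 0 , 0 , G 0) (A , B , C) + rawCoeff (map xsh Xs) (A , B , C)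
                        ≡ (if (A <ᵇ suc n) ∧ ((0 ≡ᵇ B) ∧ (G A ≡ᵇ C)) then F A else 0)
        split zero = trans (cong (coef (F 0 , 0 , 0 , G 0) (0 , B , C) +_) (rc-xsh-0 Xs B C)) (+-identityʳ _)
        split (suc A) = trans (cong (0 +_) (rc-xsh-s Xs A B C)) (go n (λ i → F (suc i)) (λ i → G (suc i)) A)

rc-sum0 : ∀ {k} (v : Vector Poly k) m → (∀ i → rawCoeff (v i) m ≡ 0) → rawCoeff (sum v) m ≡ 0
rc-sum0 {zero} v m f = refl
rc-sum0 {suc k} v m f =
  trans (rc-++ (v Fin.zero) (sum (λ i → v (Fin.suc i))) m)
        (cong₂ _+_ (f Fin.zero) (rc-sum0 (λ i → v (Fin.suc i)) m (λ i → f (Fin.suc i))))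

rc-sum1 : ∀ {k} (v : Vector Poly k) m (i₀ : Fin k) → (∀ i → toℕ i ≢ toℕ i₀ → rawCoeff (v i) m ≡ 0) →
          rawCoeff (sum v) m ≡ rawCoeff (v i₀) m
rc-sum1 {suc k} v m Fin.zero f = trans (rc-++ (v Fin.zero) (sum (λ i → v (Fin.suc i))) m)
  (trans (cong (rawCoeff (v Fin.zero) m +_) (rc-sum0 (λ i → v (Fin.suc i)) m (λ i → f (Fin.suc i) (λ ()))))
         (+-identityʳ _))
rc-sum1 {suc k} v m (Fin.suc i₀) f = trans (rc-++ (v Fin.zero) (sum (λ i → v (Fin.suc i))) m)
  (cong₂ _+_ (f Fin.zero (λ ())) (rc-sum1 (λ i → v (Fin.suc i)) m i₀ (λ i ne → f (Fin.suc i) (λ e → ne (suc-injective e)))))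

ι : UPoly → Poly
ι [] = []
ι (c ∷ f) = (c , 0 , 0 , 0) ∷ map xsh (ι f)

rc-ι : ∀ f A B C → rawCoeff (ι f) (A , B , C) ≡ (if (0 ≡ᵇ B) ∧ (0 ≡ᵇ C) then coeffU f A else 0)
rc-ι [] A B C = sym (ite0 ((0 ≡ᵇ B) ∧ (0 ≡ᵇ C)))
rc-ι (c ∷ f) zero B C = trans (cong (coef (c , 0 , 0 , 0) (0 , B , C) +_) (rc-xsh-0 (ι f) B C)) (+-identityʳ _)
rc-ι (c ∷ f) (suc A) B C = trans (cong (0 +_) (rc-xsh-s (ι f) A B C)) (rc-ι f A B C)

coeffU-add : ∀ f g A → coeffU (addU f g) A ≡ coeffU f A + coeffU g A
coeffU-add [] g A = refl
coeffU-add (a ∷ f) [] A = sym (+-identityʳ _)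
coeffU-add (a ∷ f) (b ∷ g) zero = refl
coeffU-add (a ∷ f) (b ∷ g) (suc A) = coeffU-add f g A

coeffU-scale : ∀ a f A → coeffU (scaleU a f) A ≡ a * coeffU f A
coeffU-scale a [] A = sym (*-zeroʳ a)
coeffU-scale a (b ∷ f) zero = refl
coeffU-scale a (b ∷ f) (suc A) = coeffU-scale a f A

rc-scalar : ∀ a X m → rawCoeff (mulP ((a , 0 , 0 , 0) ∷ []) X) m ≡ a * rawCoeff X m
rc-scalar a X m = trans (rc-++ (map (mulTerm (a , 0 , 0 , 0)) X) [] m) (trans (+-identityʳ _) (rc-shift (a , 0 , 0 , 0) X m))

ι-add : ∀ f g → ι (addU f g) ≈ (ι f ++ ι g)
ι-add f g = ≈i3 λ A B C → trans (rc-ι (addU f g) A B C)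
  (trans (cong (λ z → if (0 ≡ᵇ B) ∧ (0 ≡ᵇ C) then z else 0) (coeffU-add f g A))
   (trans (sym (if-+ ((0 ≡ᵇ B) ∧ (0 ≡ᵇ C)) _ _))
     (trans (cong₂ _+_ (sym (rc-ι f A B C)) (sym (rc-ι g A B C))) (sym (rc-++ (ι f) (ι g) (A , B , C))))))

ι-scale : ∀ a g → ι (scaleU a g) ≈ map (mulTerm (a , 0 , 0 , 0)) (ι g)
ι-scale a g = ≈i3 λ A B C → trans (rc-ι (scaleU a g) A B C)
  (trans (cong (λ z → if (0 ≡ᵇ B) ∧ (0 ≡ᵇ C) then z else 0) (coeffU-scale a g A))
   (trans (sym (if-mul a ((0 ≡ᵇ B) ∧ (0 ≡ᵇ C)) _))
    (trans (cong (a *_) (sym (rc-ι g A B C))) (sym (rc-shift (a , 0 , 0 , 0) (ι g) (A , B , C))))))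

ι-mul : ∀ f g → ι (mulU f g) ≈ mulP (ι f) (ι g)
ι-mul [] g = ≈-refl
ι-mul (c ∷ f) g =
  ≈-trans (ι-add (scaleU c g) (0 ∷ mulU f g))
   (++-cong≈ (ι-scale c g)
    (≈-trans (≈i λ m → cong (_+ rawCoeff (map xsh (ι (mulU f g))) m) (ite0 _))
     (≈-trans (≡⇒≈ (sym (xsh-mul (ι (mulU f g)))))
      (≈-trans (mulP-cong≈ {(1 , 1 , 0 , 0) ∷ []} ≈-refl (ι-mul f g))
       (≡⇒≈ (trans (sym (mulP-assoc ((1 , 1 , 0 , 0) ∷ []) (ι f) (ι g))) (cong (λ z → mulP z (ι g)) (xsh-mul (ι f)))))))))

ι-pow : ∀ h n → ι (powU h n) ≈ powP (ι h) n
ι-pow h zero = ≈-refl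
ι-pow h (suc n) = ≈-trans (ι-mul h (powU h n)) (mulP-cong≈ {ι h} ≈-refl (ι-pow h n))

dehom : ℕ × Mono → ℕ × Mono
dehom (c , a , b , e) = (c , a , b , 0)

dehom-mulP : ∀ P Q → map dehom (mulP P Q) ≡ mulP (map dehom P) (map dehom Q)
dehom-mulP [] Q = refl
dehom-mulP (s ∷ P) Q = trans (LP.map-++ dehom (map (mulTerm s) Q) (mulP P Q))
  (cong₂ _++_ (trans (sym (LP.map-∘ Q)) (trans (LP.map-cong (hom s) Q) (LP.map-∘ Q))) (dehom-mulP P Q))
  where hom : ∀ s t → dehom (mulTerm s t) ≡ mulTerm (dehom s) (dehom t)
        hom (c , a , b , e) (c' , a' , b' , e') = refl

dehom-pow : ∀ P n → map dehom (powP P n) ≡ powP (map dehom P) n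
dehom-pow P zero = refl
dehom-pow P (suc n) = trans (dehom-mulP P (powP P n)) (cong (mulP (map dehom P)) (dehom-pow P n))

coef-homog : ∀ d t → hdeg t ≡ d → ∀ A B C → coef t (A , B , C) ≡ (if A + C ≡ᵇ d then coef (dehom t) (A , B , 0) else 0)
coef-homog d (c₀ , a , b , e) eq A B C with (A + C) ≟ d
... | yes eq₂ rewrite ≡ᵇ-≡ eq₂ with a ≟ A
...   | yes refl rewrite ≡ᵇ-refl a | ≡ᵇ-≡ (+-cancelˡ-≡ a e C (trans eq (sym eq₂))) = refl
...   | no na rewrite ≡ᵇ-≢ na = refl
coef-homog d (c₀ , a , b , e) eq A B C | no ne rewrite ≡ᵇ-≢ ne with a ≟ A
... | no na rewrite ≡ᵇ-≢ na = refl
... | yes refl rewrite ≡ᵇ-refl a | ≡ᵇ-≢ {e} {C} (λ ec → ne (trans (cong (a +_) (sym ec)) eq)) with b ≡ᵇ B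
...   | true = refl
...   | false = refl

rc-homog : ∀ d X → All (λ t → hdeg t ≡ d) X → ∀ A B C →
           rawCoeff X (A , B , C) ≡ (if A + C ≡ᵇ d then rawCoeff (map dehom X) (A , B , 0) else 0)
rc-homog d [] All.[] A B C = sym (ite0 (A + C ≡ᵇ d))
rc-homog d (t ∷ X) (et All.∷ eX) A B C =
  trans (cong₂ _+_ (coef-homog d t et A B C) (rc-homog d X eX A B C)) (if-+ (A + C ≡ᵇ d) _ _)

module HomogenisedPower (p g : ℕ) (h : UPoly) (hd : HasDegree p h (2 * g + 1)) (N : ℕ) where
  open ModP p
  D = 2 * g + 1
  H = homog g h
  Hn = powP H N

  H-homog : All (λ t → hdeg t ≡ D) H
  H-homog = AP.map⁺ (AP.applyUpTo⁺₁ (λ i → i) (2 * g + 2) (λ {i} lt → m+[n∸m]≡n (≤-pred (subst (i <_) (+-suc (2 * g) 1) lt))))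

  H-y0 : All (λ t → ydeg t ≡ 0) H
  H-y0 = AP.map⁺ (AP.applyUpTo⁺₂ (λ i → i) (2 * g + 2) (λ i → refl))

  Hn-homog : All (λ t → hdeg t ≡ N * D) Hn
  Hn-homog = Grading.All-powP hdeg hdeg-mul H N refl H-homog

  -- dehomogenising H gives back h (mod p, since h may have trailing zeros)
  dehomH≈ι : map dehom H ≈p ι h
  dehomH≈ι = ≈pi λ where (A , B , C) → go A B C
    where
      dehomH : map dehom H ≡ map (λ i → (coeffU h i , i , 0 , 0)) (upTo (2 * g + 2))
      dehomH = sym (LP.map-∘ (upTo (2 * g + 2)))
      go : ∀ A B C → ModEq p (rawCoeff (map dehom H) (A , B , C)) (rawCoeff (ι h) (A , B , C))
      go A B C rewrite dehomH | rc-upTo (2 * g + 2) (coeffU h) (λ _ → 0) A B C | rc-ι h A B C with A <? 2 * g + 2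
      ... | yes lt rewrite ≤ᵇ-≤ lt = ≡p-refl
      ... | no nlt rewrite ≤ᵇ-≰ nlt =
        ≡p-sym (≡p-trans (≡p-if ((0 ≡ᵇ B) ∧ (0 ≡ᵇ C)) (proj₂ hd A D<A)) (≡p-≡ (ite0 ((0 ≡ᵇ B) ∧ (0 ≡ᵇ C)))))
        where D<A : D < A
              D<A = subst (_≤ A) (+-suc (2 * g) 1) (≮⇒≥ nlt)

  coeff-hⁿ : ∀ A → coeffU (powU h N) A ≡ rawCoeff (powP (ι h) N) (A , 0 , 0)
  coeff-hⁿ A = trans (sym (rc-ι (powU h N) A 0 0)) (≈o (ι-pow h N) (A , 0 , 0))

  Hn-coeff : ∀ A C → ModEq p (rawCoeff Hn (A , 0 , C)) (if A + C ≡ᵇ N * D then coeffU (powU h N) A else 0)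
  Hn-coeff A C = ≡p-trans (≡p-≡ (rc-homog (N * D) Hn Hn-homog A 0 C))
     (≡p-if (A + C ≡ᵇ N * D)
       (≡p-trans (≡p-≡ (cong (λ z → rawCoeff z (A , 0 , 0)) (dehom-pow H N)))
         (≡p-trans (≈po (powP-cong≈p N dehomH≈ι) (A , 0 , 0)) (≡p-≡ (sym (coeff-hⁿ A))))))

  hⁿ-degree : ∀ A → N * D < A → ModEq p (coeffU (powU h N) A) 0
  hⁿ-degree A lt = ≡p-trans (≡p-≡ (coeff-hⁿ A))
     (≡p-trans (≈po (powP-cong≈p N (≈p-sym dehomH≈ι)) (A , 0 , 0))
       (≡p-≡ (trans (cong (λ z → rawCoeff z (A , 0 , 0)) (sym (dehom-pow H N)))
          (rc-All0 (λ t → xdeg t ≤ N * D) (A , 0 , 0) (λ t le → coef-xdeg≤ t A 0 0 le lt) (map dehom Hn)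
             (AP.map⁺ {P = λ t → xdeg t ≤ N * D} {f = dehom}
               (All.map {P = λ t → hdeg t ≡ N * D} {Q = λ t → xdeg (dehom t) ≤ N * D} (λ {t} → x≤ {t}) Hn-homog))))))
    where x≤ : ∀ {t} → hdeg t ≡ N * D → xdeg (dehom t) ≤ N * D
          x≤ {c , a , b , e} eq = subst (a ≤_) eq (m≤m+n a e)

pow-monomial : ∀ a b w n → powP ((1 , a , b , w) ∷ []) n ≈ ((1 , n * a , n * b , n * w) ∷ [])
pow-monomial a b w zero = ≈-refl
pow-monomial a b w (suc n) = mulP-cong≈ {(1 , a , b , w) ∷ []} ≈-refl (pow-monomial a b w n)

pow-constant : ∀ k n → powP ((k , 0 , 0 , 0) ∷ []) n ≈ ((k ^ n , 0 , 0 , 0) ∷ [])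
pow-constant k zero = ≈-refl
pow-constant k (suc n) = mulP-cong≈ {(k , 0 , 0 , 0) ∷ []} ≈-refl (pow-constant k n)

negP≡ : ∀ p X → negP p X ≡ mulP ((p ∸ 1 , 0 , 0 , 0) ∷ []) X
negP≡ p X = sym (trans (LP.++-identityʳ _) (LP.map-cong (λ where (c , a , b , e) → refl) X))

+-self-injective : ∀ a b → a + a ≡ b + b → a ≡ b
+-self-injective zero zero e = refl
+-self-injective (suc a) (suc b) e =
  cong suc (+-self-injective a b (suc-injective (trans (sym (+-suc a a)) (trans (suc-injective e) (+-suc b b)))))

*2≡+ : ∀ N → N * 2 ≡ N + N
*2≡+ = solve-∀

-- Moving a z-shift W across an `if`: the coefficient of z^W·X at z^C is the
-- coefficient of X at z^(C-W); when C < W it vanishes, and the right-hand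
-- side then vanishes too as long as X does below its degree.
ite-shift : ∀ p W C A T (k X : ℕ) → (T < A → ModEq p X 0) →
  ModEq p (if W ≤ᵇ C then 1 * (k * (if A + (C ∸ W) ≡ᵇ T then X else 0)) else 0) (k * (if A + C ≡ᵇ T + W then X else 0))
ite-shift p W C A T k X hX with W ≤? C
... | yes le = ≡p-≡ (trans (cong (λ b → if b then 1 * (k * (if A + (C ∸ W) ≡ᵇ T then X else 0)) else 0) (≤ᵇ-≤ le))
                  (trans (*-identityˡ _) (cong (λ b → k * (if b then X else 0)) same)))
  where
    total : A + (C ∸ W) + W ≡ A + C
    total = trans (+-assoc A (C ∸ W) W) (cong (A +_) (m∸n+n≡m le))
    same : (A + (C ∸ W) ≡ᵇ T) ≡ (A + C ≡ᵇ T + W)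
    same with (A + (C ∸ W)) ≟ T
    ... | yes e = trans (≡ᵇ-≡ e) (sym (≡ᵇ-≡ (trans (sym total) (cong (_+ W) e))))
    ... | no ne = trans (≡ᵇ-≢ ne) (sym (≡ᵇ-≢ (λ e → ne (+-cancelʳ-≡ W _ _ (trans total e)))))
ite-shift p W C A T k X hX | no nle rewrite ≤ᵇ-≰ nle with (A + C) ≟ (T + W)
... | no ne rewrite ≡ᵇ-≢ ne = ≡p-≡ (sym (*-zeroʳ k))
... | yes e rewrite ≡ᵇ-≡ e = ≡p-sym (≡p-trans (≡p-*ˡ k (hX T<A)) (≡p-≡ (*-zeroʳ k)))
  where
    T<A : T < A
    T<A with T <? A
    ... | yes lt = lt
    ... | no nlt = ⊥-elim (<-irrefl e (+-mono-≤-< (≮⇒≥ nlt) (≰⇒> nle)))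

-- The binomial expansion of F = f^(2N) with f = Y - H, Y = y²z^(2g-1):
-- the y-degree of C(2N,k) Y^k (-H)^(2N-k) is 2k, so F has no terms of
-- y-degree > 4N, and its part of y-degree 2N is C(2N,N)(-1)^N Y^N H^N.
module MiddleTerm (p : ℕ) (g : ℕ) (h : UPoly) (hd : HasDegree p h (2 * g + 1)) (N : ℕ) where
  open ModP p
  open HomogenisedPower p g h hd N
  n = N + N
  F = powP (fPoly p g h) n
  Y : Poly
  Y = (1 , 0 , 2 , 2 * g ∸ 1) ∷ []
  H' = negP p H
  W = 2 * g ∸ 1
  c̃ : ℕ → ℕ
  c̃ A = coeffU (powU h N) A

  expansionTerm : Fin (suc n) → Poly
  expansionTerm k = binomialTerm Y H' n k

  F≈ : F ≈ sum expansionTerm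
  F≈ = ≈-trans (≡⇒≈ (sym (pow≡ (fPoly p g h) n))) (theorem n Y H')

  H'-y0 : All (λ t → ydeg t ≡ 0) H'
  H'-y0 = AP.map⁺ (All.map {Q = λ t → ydeg (negTerm p t) ≡ 0} (λ {t} → y0 {t}) H-y0)
    where y0 : ∀ {t} → ydeg t ≡ 0 → ydeg (negTerm p t) ≡ 0
          y0 {c , a , b , e} x = x

  monomialPart : ℕ → Poly
  monomialPart k = mulP (powP Y k) (powP H' (n ∸ k))

  monomialPart-y : ∀ k → All (λ t → ydeg t ≡ k * 2 + (n ∸ k) * 0) (monomialPart k)
  monomialPart-y k = Grading.All-mulP ydeg ydeg-mul (powP Y k) (powP H' (n ∸ k))
                       (Grading.All-powP ydeg ydeg-mul Y k refl (refl All.∷ All.[]))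
                       (Grading.All-powP ydeg ydeg-mul H' (n ∸ k) refl H'-y0)

  rc-term : ∀ k m → rawCoeff (expansionTerm k) m ≡ binom n (toℕ k) * rawCoeff (monomialPart (toℕ k)) m
  rc-term k m = trans (rc-× (binom n (toℕ k)) _ m) (cong (λ z → binom n (toℕ k) * rawCoeff z m)
                  (cong₂ mulP (pow≡ Y (toℕ k)) (pow≡ H' (n ∸ toℕ k))))

  term-vanishes : ∀ k A B C → B ≢ toℕ k * 2 + (n ∸ toℕ k) * 0 → rawCoeff (expansionTerm k) (A , B , C) ≡ 0
  term-vanishes k A B C ne = trans (rc-term k (A , B , C))
     (trans (cong (binom n (toℕ k) *_) (rc-All0 (λ t → ydeg t ≡ toℕ k * 2 + (n ∸ toℕ k) * 0) (A , B , C)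
                (λ t e → coef-ydeg t A B C e ne) (monomialPart (toℕ k)) (monomialPart-y (toℕ k))))
        (*-zeroʳ (binom n (toℕ k))))

  ydeg-2k : ∀ (k : Fin (suc n)) → toℕ k * 2 + (n ∸ toℕ k) * 0 ≡ toℕ k + toℕ k
  ydeg-2k k = trans (cong (toℕ k * 2 +_) (*-zeroʳ (n ∸ toℕ k))) (trans (+-identityʳ _) (*2≡+ (toℕ k)))

  high-y-vanish : ∀ A B C → n * 2 < B → rawCoeff F (A , B , C) ≡ 0
  high-y-vanish A B C lt = trans (≈o F≈ (A , B , C)) (rc-sum0 expansionTerm (A , B , C) (λ k → term-vanishes k A B C (ne k)))
    where
      ne : ∀ k → B ≢ toℕ k * 2 + (n ∸ toℕ k) * 0
      ne k e = <-irrefl refl (≤-<-trans (subst (_≤ n * 2) (sym (trans e (trans (ydeg-2k k) (sym (*2≡+ (toℕ k))))))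
                                                (*-monoˡ-≤ 2 (≤-pred (toℕ<n k)))) lt)

  N<1+n : N < suc n
  N<1+n = s≤s (m≤m+n N N)

  middle : Fin (suc n)
  middle = fromℕ< N<1+n

  term-middle : ∀ m → rawCoeff (expansionTerm middle) m ≡ binom n N * rawCoeff (mulP (powP Y N) (powP H' N)) m
  term-middle m = trans (rc-term middle m) (trans (cong (λ k → binom n k * rawCoeff (monomialPart k) m) (toℕ-fromℕ< N<1+n))
                    (cong (λ z → binom n N * rawCoeff (mulP (powP Y N) (powP H' z)) m) (m+n∸m≡n N N)))

  H'ᴺ : powP H' N ≈ mulP (((p ∸ 1) ^ N , 0 , 0 , 0) ∷ []) Hn
  H'ᴺ = ≈-trans (≡⇒≈ (cong (λ z → powP z N) (negP≡ p H)))
          (≈-trans (powP-distrib ((p ∸ 1 , 0 , 0 , 0) ∷ []) H N) (mulP-cong≈ (pow-constant (p ∸ 1) N) ≈-refl))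

  shift-Yᴺ : ∀ (G : Mono → ℕ) A C → shiftC (1 , N * 0 , N * 2 , N * W) G (A , n , C) ≡ (if N * W ≤ᵇ C then 1 * G (A , 0 , C ∸ N * W) else 0)
  shift-Yᴺ G A C rewrite *-zeroʳ N | *2≡+ N | ≤ᵇ-≤ (≤-refl {N + N}) | n∸n≡0 (N + N) = refl

  middle-coeff : ∀ A C → ModEq p (rawCoeff F (A , n , C))
                   ((binom n N * (p ∸ 1) ^ N) * (if A + C ≡ᵇ N * D + N * W then c̃ A else 0))
  middle-coeff A C =
    ≡p-trans (≡p-≡ (trans (≈o F≈ (A , n , C)) (trans (rc-sum1 expansionTerm (A , n , C) middle other) (term-middle (A , n , C)))))
     (≡p-trans (≡p-*ˡ (binom n N) Yᴺ-Hᴺ) (≡p-≡ (sym (*-assoc (binom n N) ((p ∸ 1) ^ N) _))))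
    where
      other : ∀ k → toℕ k ≢ toℕ middle → rawCoeff (expansionTerm k) (A , n , C) ≡ 0
      other k ne = term-vanishes k A n C λ e →
        ne (trans (+-self-injective (toℕ k) N (sym (trans e (ydeg-2k k)))) (sym (toℕ-fromℕ< N<1+n)))
      K' : Poly
      K' = ((p ∸ 1) ^ N , 0 , 0 , 0) ∷ []
      Yᴺ-Hᴺ : ModEq p (rawCoeff (mulP (powP Y N) (powP H' N)) (A , n , C)) ((p ∸ 1) ^ N * (if A + C ≡ᵇ N * D + N * W then c̃ A else 0))
      Yᴺ-Hᴺ = ≡p-trans (≡p-≡ (trans (≈o (mulP-cong≈ (pow-monomial 0 2 W N) H'ᴺ) (A , n , C))
                 (trans (rc-++ (map (mulTerm (1 , N * 0 , N * 2 , N * W)) (mulP K' Hn)) [] (A , n , C))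
                  (trans (+-identityʳ _) (trans (rc-shift (1 , N * 0 , N * 2 , N * W) (mulP K' Hn) (A , n , C)) (shift-Yᴺ (rawCoeff (mulP K' Hn)) A C))))))
              (≡p-trans (≡p-if (N * W ≤ᵇ C) (≡p-*ˡ 1 (≡p-trans (≡p-≡ (rc-scalar ((p ∸ 1) ^ N) Hn (A , 0 , C ∸ N * W))) (≡p-*ˡ ((p ∸ 1) ^ N) (Hn-coeff A (C ∸ N * W))))))
                 (ite-shift p (N * W) C A (N * D) ((p ∸ 1) ^ N) (c̃ A) (hⁿ-degree A)))

-- p | C(p^r, k) for 0 < k < p^r: compare the coefficient of x^k on both
-- sides of (x + 1)^(p^r) ≡ x^(p^r) + 1.
module PrimePowerBinomial (p : ℕ) (pp : Prime p) (r : ℕ) where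
  open ModP p
  open Frobenius p pp
  P = p ^ r
  x : Poly
  x = (1 , 1 , 0 , 0) ∷ []

  expansionTerm : Fin (suc P) → Poly
  expansionTerm k = binomialTerm x oneP P k

  monomialPart : ℕ → Poly
  monomialPart k = mulP (powP x k) (powP oneP (P ∸ k))

  monomialPart-x : ∀ k → All (λ t → xdeg t ≡ k * 1 + (P ∸ k) * 0) (monomialPart k)
  monomialPart-x k = Grading.All-mulP xdeg xdeg-mul (powP x k) (powP oneP (P ∸ k))
                       (Grading.All-powP xdeg xdeg-mul x k refl (refl All.∷ All.[]))
                       (Grading.All-powP xdeg xdeg-mul oneP (P ∸ k) refl (refl All.∷ All.[]))

  rc-term : ∀ k m → rawCoeff (expansionTerm k) m ≡ binom P (toℕ k) * rawCoeff (monomialPart (toℕ k)) m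
  rc-term k m = trans (rc-× (binom P (toℕ k)) _ m) (cong (λ z → binom P (toℕ k) * rawCoeff z m)
                  (cong₂ mulP (pow≡ x (toℕ k)) (pow≡ oneP (P ∸ toℕ k))))

  p∣binom : ∀ k → 0 < k → k < P → p ∣ binom P k
  p∣binom k@(suc k') 0<k k<P =
    ≡p-0⇒∣ (≡p-trans (≡p-≡ (sym (trans lhs (*-identityʳ _))))
             (≡p-trans (≈po (frobenius r (x ++ oneP)) (k , 0 , 0)) (≡p-≡ rhs)))
    where
      k<1+P : k < suc P
      k<1+P = <-trans k<P (n<1+n P)
      i₀ : Fin (suc P)
      i₀ = fromℕ< k<1+P
      xdeg-i : ∀ (i : Fin (suc P)) → toℕ i * 1 + (P ∸ toℕ i) * 0 ≡ toℕ i
      xdeg-i i = trans (cong (toℕ i * 1 +_) (*-zeroʳ (P ∸ toℕ i))) (trans (+-identityʳ _) (*-identityʳ _))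
      other : ∀ i → toℕ i ≢ toℕ i₀ → rawCoeff (expansionTerm i) (k , 0 , 0) ≡ 0
      other i ne = trans (rc-term i (k , 0 , 0)) (trans (cong (binom P (toℕ i) *_)
         (rc-All0 (λ t → xdeg t ≡ toℕ i * 1 + (P ∸ toℕ i) * 0) (k , 0 , 0)
            (λ t e → coef-xdeg≡ t k 0 0 e (λ e₂ → ne (trans (trans (sym (xdeg-i i)) (sym e₂)) (sym (toℕ-fromℕ< k<1+P)))))
            (monomialPart (toℕ i)) (monomialPart-x (toℕ i)))) (*-zeroʳ (binom P (toℕ i))))
      xᵏ : rawCoeff (monomialPart k) (k , 0 , 0) ≡ 1
      xᵏ = trans (≈o (mulP-cong≈ (pow-monomial 1 0 0 k) (pow-one (P ∸ k))) (k , 0 , 0)) e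
        where
          pow-one : ∀ m → powP oneP m ≈ oneP
          pow-one zero = ≈-refl
          pow-one (suc m) = mulP-cong≈ {oneP} ≈-refl (pow-one m)
          e : coef (1 , k * 1 + 0 , k * 0 + 0 , k * 0 + 0) (k , 0 , 0) + 0 ≡ 1
          e rewrite *-identityʳ k' | *-zeroʳ k' | +-identityʳ k' | ≡ᵇ-refl k' = refl
      lhs : rawCoeff (powP (x ++ oneP) P) (k , 0 , 0) ≡ binom P k * 1
      lhs = trans (≈o (≈-trans (≡⇒≈ (sym (pow≡ (x ++ oneP) P))) (theorem P x oneP)) (k , 0 , 0))
             (trans (rc-sum1 expansionTerm (k , 0 , 0) i₀ other)
               (trans (rc-term i₀ (k , 0 , 0))
                 (trans (cong (λ z → binom P z * rawCoeff (monomialPart z) (k , 0 , 0)) (toℕ-fromℕ< k<1+P))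
                   (cong (binom P k *_) xᵏ))))
      rhs : rawCoeff (Fr P (x ++ oneP)) (k , 0 , 0) ≡ 0
      rhs rewrite *-identityʳ P | *-zeroʳ P | ≡ᵇ-≢ {P} {suc k'} (λ e → <-irrefl (sym e) k<P) = refl

module Units (p : ℕ) (pp : Prime p) where
  p∤1 : ¬ (p ∣ 1)
  p∤1 d with prime≡2+ pp | ∣1⇒≡1 d
  ... | q , refl | ()

  p∤[p-1]^N : ∀ N → ¬ (p ∣ (p ∸ 1) ^ N)
  p∤[p-1]^N zero d = p∤1 d
  p∤[p-1]^N (suc N) d with euclidsLemma (p ∸ 1) ((p ∸ 1) ^ N) pp d
  ... | inj₂ d₂ = p∤[p-1]^N N d₂
  ... | inj₁ d₁ with prime≡2+ pp
  ...   | q , refl = <-irrefl refl (<-≤-trans (n<1+n (suc q)) (∣⇒≤ d₁))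

  -- every u with p ∤ u has an inverse modulo p (Bézout for gcd(u mod p, p) = 1)
  inverse : ∀ u → ¬ (p ∣ u) → Σ ℕ λ v → ModEq p (v * u) 1
  inverse u p∤u with prime≡2+ pp
  ... | q , refl = bézout
    where
      p' = suc q
      w = u % suc p'
      w≢0 : w ≢ 0
      w≢0 e = p∤u (m%n≡0⇒n∣m u (suc p') e)
      instance nzw : NonZero w
               nzw = ≢-nonZero w≢0
      u≡w : ModEq (suc p') u w
      u≡w = 0 , u / suc p' , trans (+-identityʳ u) (m≡m%n+[m/n]*n u (suc p'))
      rearrange : ∀ x y → 1 + y * w ≡ x * suc p' → p' * y * w + 1 * suc p' ≡ 1 + p' * x * suc p'
      rearrange x y eq = trans (expand₁ p' y w) (trans (cong (λ z → 1 + p' * z) eq) (expand₂ p' x))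
        where
          expand₁ : ∀ a b c → a * b * c + 1 * suc a ≡ 1 + a * (1 + b * c)
          expand₁ = solve-∀
          expand₂ : ∀ a b → 1 + a * (b * suc a) ≡ 1 + a * b * suc a
          expand₂ = solve-∀
      bézout : Σ ℕ λ v → ModEq (suc p') (v * u) 1
      bézout with coprime-Bézout (prime⇒coprime pp (m%n<n u (suc p')))
      ... | Bézout.+- x y eq = p' * y , ≡p-trans (≡p-*ˡ (p' * y) u≡w) (1 , p' * x , rearrange x y eq)
      ... | Bézout.-+ x y eq = y , ≡p-trans (≡p-*ˡ y u≡w) (0 , x , trans (+-identityʳ (y * w)) (sym eq))

-- If p^r = 2N + 1 then p ∤ C(2N, k) for k ≤ 2N, by Pascal's rule
-- C(2N, k) + C(2N, k+1) = C(p^r, k+1) ≡ 0 and induction from C(2N, 0) = 1.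
p∤binom[q-1] : ∀ p → Prime p → ∀ r N → p ^ r ≡ suc (N + N) → ∀ k → k ≤ N + N → ¬ (p ∣ binom (N + N) k)
p∤binom[q-1] p pp r N q≡ zero _ d = Units.p∤1 p pp d
p∤binom[q-1] p pp r N q≡ (suc k) le d = p∤binom[q-1] p pp r N q≡ k (<⇒≤ le) p∣Ck
  where
    p∣Cq : p ∣ binom (suc (N + N)) (suc k)
    p∣Cq = subst (λ z → p ∣ binom z (suc k)) q≡
             (PrimePowerBinomial.p∣binom p pp r (suc k) (s≤s z≤n) (subst (suc k <_) (sym q≡) (s≤s le)))
    p∣Ck : p ∣ binom (N + N) k
    p∣Ck = ∣m+n∣m⇒∣n (subst (p ∣_) (trans (sym (nCk+nC[k+1]≡[n+1]C[k+1] (N + N) k)) (+-comm (binom (N + N) k) _)) p∣Cq) d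

-- Write j = j' + 1,
-- g = j + t = S + 1, P = 2N + 1 and Ka α = (P - 1) + α P.  The extraction
-- reads F at x^(Ka α - j') y^(2N) z^(Ka γ - mz) with mz = 2g - 1 - j.
module Exponents (N j' t : ℕ) where
  S = j' + t
  g = suc S
  P = suc (N + N)
  mz = j' + (t + t)
  TT = (N + N) * (g + g)
  Ka : ℕ → ℕ
  Ka α = N + N + α * P

  private
    id₁ : ∀ A' C' j' mz → A' + C' + (j' + mz) ≡ (A' + j') + (C' + mz)
    id₁ = solve-∀
    id₂ : ∀ N α γ P → (N + N + α * P) + (N + N + γ * P) ≡ (N + N + (N + N)) + (α + γ) * P
    id₂ = solve-∀
    id₃ : ∀ N S → (N + N) * (suc S + suc S) + (S + S) ≡ (N + N + (N + N)) + (S + S) * suc (N + N)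
    id₃ = solve-∀
    id₄ : ∀ j' t → j' + (j' + (t + t)) ≡ (j' + t) + (j' + t)
    id₄ = solve-∀
    id₅ : ∀ S → S + suc (S + 0) ≡ suc (S + S)
    id₅ = solve-∀
    id₆ : ∀ N S → N * (2 * suc S + 1) + N * suc (S + S) ≡ (N + N) * (suc S + suc S)
    id₆ = solve-∀
    id₇ : ∀ N g j' → N * (2 * g + 1) + j' ≡ g * (N + N) + (N + j')
    id₇ = solve-∀
    id₈ : ∀ N g → g * (N + N) + (N + g) + N ≡ N + N + (g + g * (N + N))
    id₈ = solve-∀

  total : ∀ α γ → j' ≤ Ka α → mz ≤ Ka γ → ((Ka α ∸ j') + (Ka γ ∸ mz)) + (j' + mz) ≡ (N + N + (N + N)) + (α + γ) * P
  total α γ l₁ l₂ = trans (id₁ (Ka α ∸ j') (Ka γ ∸ mz) j' mz) (trans (cong₂ _+_ (m∸n+n≡m l₁) (m∸n+n≡m l₂)) (id₂ N α γ P))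

  total-TT : TT + (j' + mz) ≡ (N + N + (N + N)) + (S + S) * P
  total-TT = trans (cong (TT +_) (id₄ j' t)) (id₃ N S)

  -- the (x,z)-degree of the read-off monomial is TT = 2N·2g exactly when α + γ = 2S = 2g - 2
  on-diagonal : ∀ α γ → j' ≤ Ka α → mz ≤ Ka γ → ((Ka α ∸ j') + (Ka γ ∸ mz) ≡ᵇ TT) ≡ (α + γ ≡ᵇ S + S)
  on-diagonal α γ l₁ l₂ with (α + γ) ≟ (S + S)
  ... | yes e = trans (≡ᵇ-≡ diagonal⇐) (sym (≡ᵇ-≡ e))
    where
      diagonal⇐ : (Ka α ∸ j') + (Ka γ ∸ mz) ≡ TT
      diagonal⇐ = +-cancelʳ-≡ (j' + mz) _ _
        (trans (total α γ l₁ l₂) (trans (cong (λ z → N + N + (N + N) + z * P) e) (sym total-TT)))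
  ... | no ne = trans (≡ᵇ-≢ (λ e → ne (diagonal⇒ e))) (sym (≡ᵇ-≢ ne))
    where
      diagonal⇒ : (Ka α ∸ j') + (Ka γ ∸ mz) ≡ TT → α + γ ≡ S + S
      diagonal⇒ e = *-cancelʳ-≡ (α + γ) (S + S) P (+-cancelˡ-≡ (N + N + (N + N)) _ _
        (trans (sym (total α γ l₁ l₂)) (trans (cong (_+ (j' + mz)) e) total-TT)))

  support : ∀ α γ → ((α <ᵇ g) ∧ ((2 * g ∸ 2) ∸ α ≡ᵇ γ)) ≡ ((α <ᵇ g) ∧ (α + γ ≡ᵇ S + S))
  support α γ rewrite cong (_∸ 1) (id₅ S) with α <? g
  ... | no nlt rewrite ≤ᵇ-≰ nlt = refl
  ... | yes lt rewrite ≤ᵇ-≤ lt = same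
    where
      α≤ : α ≤ S + S
      α≤ = ≤-trans (≤-pred lt) (m≤m+n S S)
      same : ((S + S) ∸ α ≡ᵇ γ) ≡ (α + γ ≡ᵇ S + S)
      same with ((S + S) ∸ α) ≟ γ
      ... | yes e = trans (≡ᵇ-≡ e) (sym (≡ᵇ-≡ (trans (cong (α +_) (sym e)) (m+[n∸m]≡n α≤))))
      ... | no ne = trans (≡ᵇ-≢ ne) (sym (≡ᵇ-≢ (λ e → ne (trans (cong (_∸ α) (sym e)) (m+n∸m≡n α γ)))))

  middle-degree : N * (2 * g + 1) + N * (2 * g ∸ 1) ≡ TT
  middle-degree = trans (cong (λ z → N * (2 * g + 1) + N * z) (id₅ S)) (id₆ N S)

  mz-eq : 2 * g ∸ 1 ∸ suc j' ≡ mz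
  mz-eq = trans (cong (_∸ suc j') (id₅ S)) (trans (cong (_∸ j') (sym (id₄ j' t))) (m+n∸m≡n j' (j' + (t + t))))

  -- on the support the z-shift never underflows
  mz≤ : ∀ α γ → 1 ≤ N → α < g → α + γ ≡ S + S → mz ≤ Ka γ
  mz≤ α γ 1≤N lt e = ≤-trans mz≤2S (≤-trans 2S≤SP (≤-trans (*-monoˡ-≤ P S≤γ) (m≤n+m (γ * P) (N + N))))
    where
      S≤γ : S ≤ γ
      S≤γ = +-cancelˡ-≤ S S γ (subst (_≤ S + γ) e (+-monoˡ-≤ γ (≤-pred lt)))
      mz≤2S : mz ≤ S + S
      mz≤2S = subst (mz ≤_) (id₄ j' t) (m≤n+m mz j')
      2S≤SP : S + S ≤ S * P
      2S≤SP = subst (S + S ≤_) (sym (*-suc S (N + N))) (+-monoʳ-≤ S (S≤S*2N 1≤N))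
        where S≤S*2N : 1 ≤ N → S ≤ S * (N + N)
              S≤S*2N (s≤s z≤n) = m≤m*n S (N + N)

  -- off the support (α ≥ g) the x-exponent exceeds deg h^N
  beyond-degree : ∀ α → g ≤ α → j' ≤ Ka α → N * (2 * g + 1) < Ka α ∸ j'
  beyond-degree α g≤α l₁ = +-cancelʳ-< j' _ _ (subst (N * (2 * g + 1) + j' <_) (sym (m∸n+n≡m l₁)) lt)
    where
      lt : N * (2 * g + 1) + j' < Ka α
      lt = ≤-trans (subst (_< g * (N + N) + (N + g)) (sym (id₇ N g j')) (+-monoʳ-< (g * (N + N)) (+-monoʳ-< N (s≤s (m≤m+n j' t)))))
             (≤-trans (m≤m+n (g * (N + N) + (N + g)) N) (subst (_≤ Ka α) (sym (id₈ N g))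
               (+-monoʳ-≤ (N + N) (subst (_≤ α * P) (*-suc g (N + N)) (*-monoˡ-≤ P g≤α)))))

-- The coefficient comparison, for any coefficient function F with the two
-- properties established for f^(2N) in MiddleTerm: v times the extracted
-- coefficient at (α, β, γ) is the coefficient of h_{r,j} (with c̃ = coefficients of h^N).
extraction-coeff : ∀ (p N j' t : ℕ) → 1 ≤ N → (P : ℕ) → P ≡ suc (N + N) →
  (F : Mono → ℕ) (v u : ℕ) → ModEq p (v * u) 1 → (c̃ : ℕ → ℕ) →
  (∀ A → N * (2 * (suc j' + t) + 1) < A → ModEq p (c̃ A) 0) →
  (∀ A B C → (N + N) * 2 < B → F (A , B , C) ≡ 0) →
  (∀ A C → ModEq p (F (A , N + N , C)) (u * (if A + C ≡ᵇ N * (2 * (suc j' + t) + 1) + N * (2 * (suc j' + t) ∸ 1) then c̃ A else 0))) →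
  ∀ α β γ → ModEq p (v * shiftC (1 , j' , 0 , 2 * (suc j' + t) ∸ 1 ∸ suc j') F (P ∸ 1 + α * P , P ∸ 1 + β * P , P ∸ 1 + γ * P))
     (if (α <ᵇ suc j' + t) ∧ ((0 ≡ᵇ β) ∧ ((2 * (suc j' + t) ∸ 2) ∸ α ≡ᵇ γ)) then (if suc j' ≤ᵇ suc α * P then c̃ (suc α * P ∸ suc j') else 0) else 0)
-- y-exponent above 2N: both sides vanish
extraction-coeff p N j' t _ .(suc (N + N)) refl F v _ _ _ _ high _ α (suc β') γ =
  ≡p-≡ (trans (cong (v *_) (lhs0 ((j' ≤ᵇ Ka α) ∧ (true ∧ (mz' ≤ᵇ Ka γ))) (high _ _ _ lt)))
          (trans (*-zeroʳ v) (sym (cong (λ b → if b then _ else 0) (∧-zeroʳ (α <ᵇ suc j' + t))))))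
  where
    open Exponents N j' t
    mz' = 2 * (suc j' + t) ∸ 1 ∸ suc j'
    lhs0 : ∀ c {x} → x ≡ 0 → (if c then 1 * x else 0) ≡ 0
    lhs0 true refl = refl
    lhs0 false _ = refl
    lt : (N + N) * 2 < N + N + suc β' * P
    lt = subst (_< N + N + suc β' * P) (sym (*2≡+ (N + N))) (+-monoʳ-< (N + N) (s≤s (m≤m+n (N + N) (β' * P))))
-- y-exponent exactly 2N: the middle term of the binomial expansion
extraction-coeff p N j' t 1≤N .(suc (N + N)) refl F v u vu c̃ degB _ middle α zero γ = main
  where
    open Exponents N j' t
    middle' : ∀ A C → ModEq p (F (A , N + N + 0 * P , C)) (u * (if A + C ≡ᵇ TT then c̃ A else 0))
    middle' A C = subst (λ z → ModEq p (F (A , z , C)) (u * (if A + C ≡ᵇ TT then c̃ A else 0))) (sym (+-identityʳ (N + N)))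
                (subst (λ z → ModEq p (F (A , N + N , C)) (u * (if A + C ≡ᵇ z then c̃ A else 0))) middle-degree (middle A C))
    RHS = (if (α <ᵇ g) ∧ (true ∧ ((2 * g ∸ 2) ∸ α ≡ᵇ γ)) then (if suc j' ≤ᵇ suc α * P then c̃ (suc α * P ∸ suc j') else 0) else 0)
    main : ModEq p (v * (if (j' ≤ᵇ Ka α) ∧ (true ∧ (2 * g ∸ 1 ∸ suc j' ≤ᵇ Ka γ)) then 1 * F (Ka α ∸ j' , N + N + 0 * P , Ka γ ∸ (2 * g ∸ 1 ∸ suc j')) else 0)) RHS
    main rewrite mz-eq | support α γ with j' ≤? Ka α
    ... | no nl₁ rewrite ≤ᵇ-≰ nl₁ | ≤ᵇ-≰ {suc j'} {suc (Ka α)} (λ le → nl₁ (≤-pred le)) =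
          ≡p-≡ (trans (*-zeroʳ v) (sym (ite0 ((α <ᵇ g) ∧ (α + γ ≡ᵇ S + S)))))
    ... | yes l₁ rewrite ≤ᵇ-≤ l₁ | ≤ᵇ-≤ {suc j'} {suc (Ka α)} (s≤s l₁) with (α + γ) ≟ (S + S)
    ...   | no ne rewrite ≡ᵇ-≢ ne | ∧-zeroʳ (α <ᵇ g) = ≡p-trans (≡p-*ˡ v lhs) (≡p-≡ (*-zeroʳ v))
      where
        lhs : ModEq p (if mz ≤ᵇ Ka γ then 1 * F (Ka α ∸ j' , N + N + 0 * P , Ka γ ∸ mz) else 0) 0
        lhs with mz ≤? Ka γ
        ... | no nl₂ rewrite ≤ᵇ-≰ nl₂ = ≡p-refl
        ... | yes l₂ rewrite ≤ᵇ-≤ l₂ = ≡p-trans (≡p-≡ (+-identityʳ _)) (≡p-trans (middle' _ _)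
                 (≡p-≡ (trans (cong (λ b → u * (if b then c̃ (Ka α ∸ j') else 0)) (trans (on-diagonal α γ l₁ l₂) (≡ᵇ-≢ ne))) (*-zeroʳ u))))
    ...   | yes e rewrite ≡ᵇ-≡ e with α <? g
    ...     | yes lt rewrite ≤ᵇ-≤ lt | ≤ᵇ-≤ (mz≤ α γ 1≤N lt e) =
               ≡p-trans (≡p-*ˡ v (≡p-trans (≡p-≡ (+-identityʳ _)) (≡p-trans (middle' _ _)
                   (≡p-≡ (cong (λ b → u * (if b then c̃ (Ka α ∸ j') else 0)) (trans (on-diagonal α γ l₁ (mz≤ α γ 1≤N lt e)) (≡ᵇ-≡ e)))))))
                (≡p-trans (≡p-≡ (sym (*-assoc v u _))) (≡p-trans (≡p-* vu (≡p-refl {m = c̃ (Ka α ∸ j')})) (≡p-≡ (+-identityʳ _))))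
    ...     | no nlt rewrite ≤ᵇ-≰ nlt = ≡p-trans (≡p-*ˡ v lhs) (≡p-≡ (*-zeroʳ v))
      where
        c0 : ModEq p (c̃ (Ka α ∸ j')) 0
        c0 = degB (Ka α ∸ j') (beyond-degree α (≮⇒≥ nlt) l₁)
        lhs : ModEq p (if mz ≤ᵇ Ka γ then 1 * F (Ka α ∸ j' , N + N + 0 * P , Ka γ ∸ mz) else 0) 0
        lhs = ≡p-if0 (mz ≤ᵇ Ka γ) (≡p-trans (≡p-≡ (+-identityʳ _)) (≡p-trans (middle' _ _)
                (≡p-trans (≡p-*ˡ u (≡p-if0 (Ka α ∸ j' + (Ka γ ∸ mz) ≡ᵇ TT) c0)) (≡p-≡ (*-zeroʳ u)))))

odd-prime-power : ∀ {p} → Prime p → p ≢ 2 → ∀ r → Σ ℕ λ N → p ^ r ≡ suc (N + N)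
odd-prime-power {p} pp p≢2 zero = 0 , refl
odd-prime-power {p} pp p≢2 (suc r) with p-odd | odd-prime-power pp p≢2 r
  where
    parity : ∀ n → Σ ℕ λ k → (n ≡ k + k) ⊎ (n ≡ suc (k + k))
    parity zero = 0 , inj₁ refl
    parity (suc n) with parity n
    ... | k , inj₁ e = k , inj₂ (cong suc e)
    ... | k , inj₂ e = suc k , inj₁ (trans (cong suc e) (cong suc (sym (+-suc k k))))
    p-odd : Σ ℕ λ a → p ≡ suc (a + a)
    p-odd with parity p
    ... | a , inj₂ e = a , e
    ... | a , inj₁ e with prime⇒irreducible pp (divides a (trans e (+-self≡*2 a)))
      where +-self≡*2 : ∀ a → a + a ≡ a * 2
            +-self≡*2 = solve-∀
    ...   | inj₁ ()
    ...   | inj₂ e₂ = ⊥-elim (p≢2 (sym e₂))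
... | a , p≡ | N , q≡ = a + N + 2 * a * N , trans (cong₂ _*_ p≡ q≡) (odd*odd a N)
  where odd*odd : ∀ a b → suc (a + a) * suc (b + b) ≡ suc ((a + b + 2 * a * b) + (a + b + 2 * a * b))
        odd*odd = solve-∀

half-positive : ∀ {p} → Prime p → ∀ r → 1 ≤ r → ∀ N → p ^ r ≡ suc (N + N) → 1 ≤ N
half-positive pp r r≥1 (suc N) q≡ = s≤s z≤n
half-positive {p} pp (suc r) r≥1 zero q≡ with prime≡2+ pp
... | q , refl = ⊥-elim (<-irrefl (sym q≡) (≤-trans (s≤s (s≤s z≤n)) (m≤m*n (suc (suc q)) (suc (suc q) ^ r) {{m^n≢0 (suc (suc q)) r}})))

module Membership (p : ℕ) (pp : Prime p) (j' t : ℕ) (h : UPoly) (r : ℕ)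
                  (hd : HasDegree p h (2 * (suc j' + t) + 1))
                  (N : ℕ) (q≡ : p ^ r ≡ suc (N + N)) (1≤N : 1 ≤ N) where
  g = suc j' + t
  mz = 2 * g ∸ 1 ∸ suc j'
  private
    instance
      nzP : NonZero (p ^ r)
      nzP = m^n≢0 p r {{prime⇒nonZero pp}}
  open Extraction (p ^ r) j' 0 mz using (E; rc-E)
  open MiddleTerm p g h hd N using (F; high-y-vanish; middle-coeff; c̃)
  open HomogenisedPower p g h hd N using (hⁿ-degree)

  -- u = C(2N, N)·(-1)^N is a unit mod p, with inverse v
  u = binom (N + N) N * (p ∸ 1) ^ N

  p∤u : ¬ (p ∣ u)
  p∤u d with euclidsLemma (binom (N + N) N) ((p ∸ 1) ^ N) pp d
  ... | inj₁ d₁ = p∤binom[q-1] p pp r N q≡ N (m≤m+n N N) d₁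
  ... | inj₂ d₂ = Units.p∤[p-1]^N p pp N d₂

  v = proj₁ (Units.inverse p pp u p∤u)

  q-1≡2N : p ^ r ∸ 1 ≡ N + N
  q-1≡2N = cong (_∸ 1) q≡

  half : ⌊ (p ^ r ∸ 1) /2⌋ ≡ N
  half = trans (cong ⌊_/2⌋ q-1≡2N) (sym (n≡⌊n+n/2⌋ N))

  v·E[F]≡h : PolyEq p (mulP ((v , 0 , 0 , 0) ∷ []) (E F)) (hPoly p g h r (suc j'))
  v·E[F]≡h (α , β , γ) =
    ≡p-trans (≡p-≡ (trans (rc-scalar v (E F) (α , β , γ)) (cong (v *_) (rc-E F (α , β , γ)))))
     (≡p-trans (extraction-coeff p N j' t 1≤N (p ^ r) q≡ (rawCoeff F) v u (proj₂ (Units.inverse p pp u p∤u))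
                  c̃ hⁿ-degree high-y-vanish middle-coeff α β γ)
       (≡p-≡ (sym (trans (rc-upTo g (λ i → Cmat p h r (suc i) (suc j')) (λ i → (2 * g ∸ 2) ∸ i) α β γ)
          (cong (λ M → if (α <ᵇ g) ∧ ((0 ≡ᵇ β) ∧ ((2 * g ∸ 2) ∸ α ≡ᵇ γ))
                        then (if suc j' ≤ᵇ suc α * p ^ r then coeffU (powU h M) (suc α * p ^ r ∸ suc j') else 0)
                        else 0) half)))))

  hPoly∈I : InI p r (powP (fPoly p g h) (p ^ r ∸ 1)) (hPoly p g h r (suc j'))
  hPoly∈I J isI F∈J^[q] =
    IsIdeal.respects isI v·E[F]≡h (IsIdeal.*-closed isI ((v , 0 , 0 , 0) ∷ []) (E∈I p pp r j' 0 mz F J isI F∈J^[q]'))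
    where F∈J^[q]' : InFrobPow p r J F
          F∈J^[q]' = subst (λ k → InFrobPow p r J (powP (fPoly p g h) k)) q-1≡2N F∈J^[q]

-- Lemma 3.6.
lemma3p6 : (p : ℕ) → Prime p → p ≢ 2 →
    (g : ℕ) → 2 ≤ g →
    (h : UPoly) → HasDegree p h (2 * g + 1) → Separable p h →
    (r : ℕ) → 1 ≤ r →
    (j : ℕ) → 1 ≤ j → j ≤ g →
    InI p r (powP (fPoly p g h) (p ^ r ∸ 1)) (hPoly p g h r j)
lemma3p6 p pp p≢2 g _ h hd _ r r≥1 (suc j') _ j≤g with odd-prime-power pp p≢2 r
... | N , q≡ =
  -- write g = (j' + 1) + t to match the parametrisation of Membership
  subst (λ G → HasDegree p h (2 * G + 1) → InI p r (powP (fPoly p G h) (p ^ r ∸ 1)) (hPoly p G h r (suc j')))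
    (m+[n∸m]≡n j≤g)
    (λ hd' → Membership.hPoly∈I p pp j' (g ∸ suc j') h r hd' N q≡ (half-positive pp r r≥1 N q≡))
    hd
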